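{- If $\alpha=(\alpha_1,\alpha_2,\dots,\alpha_r)$ is a type-$B$ composition of $n$ (with $\alpha_1,\dots,\alpha_r$ its nonzero components), then \[\ell_S(\omega_{\mathsf{o};\alpha})=n^2-\sum_{i=1}^r\binom{\alpha_i}{2}-\begin{cases}\binom{\alpha_1+1}{2},&\text{if }\alpha\text{ is join},\\0,&\text{if }\alpha\text{ is split}.\end{cases}\]
   Context: $\mathfrak{H}_n$: permutations $\pi$ of $\pm[n]=\{ -n,\dots,-1,1,\dots,n\}$ with $\pi(-a)=-\pi(a)$, product = composition; Coxeter group of type $B_n$ with simple generators $S=\{s_0,\dots,s_{n-1}\}$, $s_0$ exchanging $1,-1$ and $s_i$ exchanging $i,i+1$ and $-i,-i-1$; $\ell_S$ is Coxeter length. A type-$B$ composition of $n$ is a sequence $(\alpha_1,\dots,\alpha_r)$ of positive integers summing to $n$, possibly preceded by a component $0$ (split if present, join otherwise). $p_i=\alpha_1+\dots+\alpha_i$; $J_\alpha=\{s_{p_1},\dots,s_{p_{r-1}}\}$, plus $s_0$ if split; $\mathfrak{H}_\alpha=\{w\in\mathfrak{H}_n:\ell_S(ws)>\ell_S(w)\ \forall s\in S\setminus J_\alpha\}$, and $\omega_{\mathsf{o};\alpha}$ is its element of maximal length. -}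

module Defs where

open import Data.Bool using (Bool; true; false; not; if_then_else_)
open import Data.Nat using (ℕ; zero; suc; _+_; _*_; _∸_; _≤_; _<_)
open import Data.Nat.Combinatorics using (_C_)
open import Data.Fin using (Fin; zero; suc; toℕ; inject₁; _≟_)
open import Data.List using (List; []; _∷_; length; map)
open import Data.Nat.ListAction using (sum)
open import Data.List.Relation.Unary.All using (All)
open import Data.List.Membership.Propositional using (_∈_)
open import Data.Product using (Σ; _×_; _,_; ∃)
open import Data.Sum using (_⊎_)
open import Function using (_∘_; id; _↔_; Inverse)
open import Relation.Nullary using (¬_; does)
open import Relation.Binary.PropositionalEquality using (_≡_)

-- ±[n] : the element (b , a) stands for  ± (toℕ a + 1),
-- with b = true meaning the negative sign.

SFin : ℕ → Set
SFin n = Bool × Fin n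

neg : ∀ {n} → SFin n → SFin n
neg (b , a) = (not b , a)

record Hyp (n : ℕ) : Set where
  field
    perm : SFin n ↔ SFin n
    odd  : ∀ a → Inverse.to perm (neg a) ≡ neg (Inverse.to perm a)

  fun : SFin n → SFin n
  fun = Inverse.to perm

open Hyp public

_≈_ : ∀ {n} → (SFin n → SFin n) → (SFin n → SFin n) → Set
f ≈ g = ∀ a → f a ≡ g a

-- Simple generators s_0, …, s_{n-1}, indexed by Fin n.
-- s_0 exchanges 1 and -1; s_i (i ≥ 1) exchanges i,i+1 and -i,-i-1.
-- (Value k ∈ [n] is Fin index k-1, so s_(suc j) swaps indices j and j+1.)

swapFin : ∀ {n} → Fin n → Fin n → Fin n → Fin n
swapFin i j a =
  if does (a ≟ i) then j else (if does (a ≟ j) then i else a)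

gen : ∀ {n} → Fin n → SFin n → SFin n
gen zero    (b , zero)    = (not b , zero)
gen zero    (b , suc a)   = (b , suc a)
gen (suc j) (b , a)       = (b , swapFin (inject₁ j) (suc j) a)

evalWord : ∀ {n} → List (Fin n) → SFin n → SFin n
evalWord []       = id
evalWord (i ∷ ws) = gen i ∘ evalWord ws

HasLength : ∀ {n} → (SFin n → SFin n) → ℕ → Set
HasLength {n} f k =
  (Σ (List (Fin n)) λ ws → length ws ≡ k × evalWord ws ≈ f)
  × (∀ (ws : List (Fin n)) → evalWord ws ≈ f → k ≤ length ws)

-- Type-B compositions of n: a split flag (true iff a leading 0 component
-- is present) and the list (α_1, …, α_r) of nonzero components.

record BComp (n : ℕ) : Set where
  field
    split : Bool
    parts : List ℕ
    pos   : All (λ x → 0 < x) parts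
    total : sum parts ≡ n

open BComp public

psumsFrom : ℕ → List ℕ → List ℕ
psumsFrom acc []           = []
psumsFrom acc (x ∷ [])     = []
psumsFrom acc (x ∷ y ∷ xs) = (acc + x) ∷ psumsFrom (acc + x) (y ∷ xs)

psums : List ℕ → List ℕ
psums = psumsFrom 0

InJ : ∀ {n} → BComp n → Fin n → Set
InJ α i = (split α ≡ true × toℕ i ≡ 0) ⊎ (toℕ i ∈ psums (parts α))

InHα : ∀ {n} → BComp n → Hyp n → Set
InHα α w = ∀ i → ¬ InJ α i → ∀ k m →
  HasLength (fun w) k → HasLength (fun w ∘ gen i) m → k < m

-- α_1 (the first nonzero component; 0 if there is none, i.e. n = 0)
firstPart : List ℕ → ℕ
firstPart []      = 0
firstPart (x ∷ _) = x

lengthFormula : ∀ {n} → BComp n → ℕ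
lengthFormula {n} α =
  n * n ∸ sum (map (λ a → a C 2) (parts α))
        ∸ (if split α then 0 else (suc (firstPart (parts α)) C 2))

-- m is the maximal Coxeter length attained on 𝔥_α
-- (so m = ℓ_S(ω_{o;α}) for the longest element ω_{o;α} of 𝔥_α).
MaxLengthIs : ∀ {n} → BComp n → ℕ → Set
MaxLengthIs {n} α m =
  (Σ (Hyp n) λ w → InHα α w × HasLength (fun w) m)
  × (∀ (w : Hyp n) → InHα α w → ∀ k → HasLength (fun w) k → k ≤ m)

{-# OPTIONS --safe #-}
-- Write a signed permutation w through its window (w(1), …, w(n)).  The
-- count inv + neg + nsp of that window changes by exactly ±1 under right
-- multiplication by a generator, decreasing precisely at a descent; it is 0
-- only for the identity, and any w with a positive count has a descent.  Hence
-- it is the Coxeter length ℓ_S.  An element of 𝔥_α has no descent outside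
-- J_α, so its window increases inside each block of α and, when α is join, is
-- positive on the first block; the pairs this forbids as inversions number
-- Σ C(α_i,2) + [join] C(α_1+1,2) out of the n² possible.  The window that
-- reverses and negates every block (keeping a join first block in place) lies
-- in 𝔥_α and has all remaining inversions, so it attains the bound.

module Submission where

open import Defs
import Data.Nat.Properties as ℕ
open import Algebra.Properties.CommutativeSemigroup ℕ.+-commutativeSemigroup
  using (x∙yz≈y∙xz; xy∙z≈xz∙y; interchange)
open import Data.Bool using (Bool; true; false; not; _xor_; if_then_else_)
open import Data.Bool.Properties
  using (not-involutive; ¬-not; xor-assoc; xor-same; xor-identityʳ; not-distribʳ-xor)
  renaming (_≟_ to _≟ᵇ_)
open import Data.Empty using (⊥-elim)
open import Data.Fin using (Fin; zero; suc; toℕ; inject₁; fromℕ<)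
open import Data.Fin.Properties using (toℕ-injective; toℕ<n; toℕ-fromℕ<; toℕ-inject₁; any?)
  renaming (_≟_ to _≟ᶠ_)
open import Data.Integer using (ℤ; +[1+_]; -[1+_]; -_; 0ℤ; ∣_∣; +≤+; +<+; -<+; -<-)
  renaming (_≤_ to _≤ℤ_; _<_ to _<ℤ_)
import Data.Integer.Properties as ℤ
open import Data.List using (List; []; _∷_; length; _++_; map)
import Data.List.Properties as List
open import Data.List.Membership.Propositional using (_∈_; _∉_)
open import Data.List.Relation.Unary.All using (All; _∷_)
open import Data.List.Relation.Unary.Any using (here; there)
open import Data.Nat using (ℕ; zero; suc; _+_; _*_; _∸_; _≤_; _<_; z≤n; s≤s)
open import Data.Nat.Combinatorics using (_C_; nCk+nC[k+1]≡[n+1]C[k+1]; nC1≡n)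
open import Data.Nat.ListAction using (sum)
open import Data.Nat.Tactic.RingSolver using (solve-∀)
open import Data.Product using (Σ; ∃; _×_; _,_; proj₁; proj₂)
open import Data.Sum using (inj₁; inj₂)
open import Function using (_∘_; id; Inverse; mk↔ₛ′)
open import Relation.Nullary using (¬_; does; yes; no)
open import Relation.Nullary.Decidable using (dec-true; dec-false)
open import Relation.Binary.PropositionalEquality

⟦_⟧ : Bool → ℕ
⟦ true  ⟧ = 1
⟦ false ⟧ = 0

⟦⟧≤1 : ∀ b → ⟦ b ⟧ ≤ 1
⟦⟧≤1 true  = s≤s z≤n
⟦⟧≤1 false = z≤n

infix 4 _<ᵇ_

_<ᵇ_ : ℤ → ℤ → Bool
x <ᵇ y = does (x ℤ.<? y)

<ᵇ-true : ∀ {x y} → x <ℤ y → (x <ᵇ y) ≡ true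
<ᵇ-true {x} {y} = dec-true (x ℤ.<? y)

<ᵇ-false : ∀ {x y} → y ≤ℤ x → (x <ᵇ y) ≡ false
<ᵇ-false {x} {y} y≤x = dec-false (x ℤ.<? y) (ℤ.≤⇒≯ y≤x)

tail : ∀ {A : Set} → (ℕ → A) → ℕ → A
tail v k = v (suc k)

-- Type-B inversions of a window

count : ℕ → (ℕ → ℤ) → (ℤ → Bool) → ℕ
count zero    v P = 0
count (suc m) v P = ⟦ P (v 0) ⟧ + count m (tail v) P

-- Ω k = w(k+1); inv counts Björner–Brenti's inv, negInv their neg + nsp.

inv : ℕ → (ℕ → ℤ) → ℕ
inv zero    Ω = 0
inv (suc n) Ω = count n (tail Ω) (_<ᵇ Ω 0) + inv n (tail Ω)

negInv : ℕ → (ℕ → ℤ) → ℕ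
negInv zero    Ω = 0
negInv (suc n) Ω = count n (tail Ω) (_<ᵇ (- Ω 0)) + ⟦ Ω 0 <ᵇ 0ℤ ⟧ + negInv n (tail Ω)

lengthB : ℕ → (ℕ → ℤ) → ℕ
lengthB n Ω = inv n Ω + negInv n Ω

count-cong : ∀ m {v u} P → (∀ k → v k ≡ u k) → count m v P ≡ count m u P
count-cong zero    P v≗u = refl
count-cong (suc m) P v≗u =
  cong₂ _+_ (cong (λ z → ⟦ P z ⟧) (v≗u 0)) (count-cong m P (v≗u ∘ suc))

inv-cong : ∀ n {Ω Ψ} → (∀ k → Ω k ≡ Ψ k) → inv n Ω ≡ inv n Ψ
inv-cong zero    Ω≗Ψ = refl
inv-cong (suc n) {Ψ = Ψ} Ω≗Ψ = cong₂ _+_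
  (trans (count-cong n _ (Ω≗Ψ ∘ suc)) (cong (λ z → count n (tail Ψ) (_<ᵇ z)) (Ω≗Ψ 0)))
  (inv-cong n (Ω≗Ψ ∘ suc))

negInv-cong : ∀ n {Ω Ψ} → (∀ k → Ω k ≡ Ψ k) → negInv n Ω ≡ negInv n Ψ
negInv-cong zero    Ω≗Ψ = refl
negInv-cong (suc n) {Ψ = Ψ} Ω≗Ψ = cong₂ _+_ (cong₂ _+_
  (trans (count-cong n _ (Ω≗Ψ ∘ suc)) (cong (λ z → count n (tail Ψ) (_<ᵇ (- z))) (Ω≗Ψ 0)))
  (cong (λ z → ⟦ z <ᵇ 0ℤ ⟧) (Ω≗Ψ 0)))
  (negInv-cong n (Ω≗Ψ ∘ suc))

lengthB-cong : ∀ n {Ω Ψ} → (∀ k → Ω k ≡ Ψ k) → lengthB n Ω ≡ lengthB n Ψ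
lengthB-cong n Ω≗Ψ = cong₂ _+_ (inv-cong n Ω≗Ψ) (negInv-cong n Ω≗Ψ)

-- The right action of the generators on windows: s₀ negates the first
-- entry, s_{j+1} exchanges the entries at positions j and j+1.

swapℕ : ℕ → ℕ → ℕ
swapℕ zero    zero          = 1
swapℕ zero    (suc zero)    = 0
swapℕ zero    (suc (suc k)) = suc (suc k)
swapℕ (suc j) zero          = zero
swapℕ (suc j) (suc k)       = suc (swapℕ j k)

negHead : (ℕ → ℤ) → ℕ → ℤ
negHead Ω zero    = - Ω zero
negHead Ω (suc k) = Ω (suc k)

act : ℕ → (ℕ → ℤ) → ℕ → ℤ
act zero    Ω = negHead Ω
act (suc j) Ω = Ω ∘ swapℕ j

isDescent : (ℕ → ℤ) → ℕ → Bool
isDescent Ω zero    = Ω 0 <ᵇ 0ℤ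
isDescent Ω (suc j) = Ω (suc j) <ᵇ Ω j

isAscent : (ℕ → ℤ) → ℕ → Bool
isAscent Ω zero    = - Ω 0 <ᵇ 0ℤ
isAscent Ω (suc j) = Ω j <ᵇ Ω (suc j)

count-swap : ∀ m j v P → suc j < m → count m (v ∘ swapℕ j) P ≡ count m v P
count-swap (suc (suc m)) zero    v P _       = x∙yz≈y∙xz ⟦ P (v 1) ⟧ ⟦ P (v 0) ⟧ _
count-swap (suc m)       (suc j) v P (s≤s h) = cong (λ c → ⟦ P (v 0) ⟧ + c) (count-swap m j (tail v) P h)

<ᵇ-neg : ∀ x y → (y <ᵇ - x) ≡ (x <ᵇ - y)
<ᵇ-neg x y with y ℤ.<? - x | x ℤ.<? - y
... | yes _ | yes _ = refl
... | no  _ | no  _ = refl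
... | yes p | no ¬q = ⊥-elim (¬q (subst (_<ℤ - y) (ℤ.neg-involutive x) (ℤ.neg-mono-< p)))
... | no ¬p | yes q = ⊥-elim (¬p (subst (_<ℤ - x) (ℤ.neg-involutive y) (ℤ.neg-mono-< q)))

<ᵇ⇒< : ∀ {x y} → (x <ᵇ y) ≡ true → x <ℤ y
<ᵇ⇒< {x} {y} x<ᵇy with x ℤ.<? y
... | yes x<y = x<y

<ᵇ-false⇒≥ : ∀ {x y} → (x <ᵇ y) ≡ false → y ≤ℤ x
<ᵇ-false⇒≥ {x} {y} x≮ᵇy with x ℤ.<? y
... | no x≮y = ℤ.≮⇒≥ x≮y

inv-swap : ∀ n j Ω → suc j < n →
           inv n (Ω ∘ swapℕ j) + ⟦ isDescent Ω (suc j) ⟧ ≡ inv n Ω + ⟦ isAscent Ω (suc j) ⟧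
inv-swap (suc (suc m)) zero Ω _ =
  rearrange ⟦ isAscent Ω 1 ⟧ ⟦ isDescent Ω 1 ⟧
            (count m (tail (tail Ω)) (_<ᵇ Ω 1)) (count m (tail (tail Ω)) (_<ᵇ Ω 0)) (inv m (tail (tail Ω)))
  where
  rearrange : ∀ a b c d e → (a + c + (d + e)) + b ≡ (b + d + (c + e)) + a
  rearrange = solve-∀
inv-swap (suc n) (suc j) Ω (s≤s h) = begin
  c′ + inv n (tail Ω ∘ swapℕ j) + d  ≡⟨ cong (λ z → z + inv n (tail Ω ∘ swapℕ j) + d) (count-swap n j (tail Ω) _ h) ⟩
  c + inv n (tail Ω ∘ swapℕ j) + d  ≡⟨ ℕ.+-assoc c _ d ⟩
  c + (inv n (tail Ω ∘ swapℕ j) + d) ≡⟨ cong (λ z → c + z) (inv-swap n j (tail Ω) h) ⟩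
  c + (inv n (tail Ω) + a)           ≡⟨ ℕ.+-assoc c _ a ⟨
  c + inv n (tail Ω) + a             ∎
  where
  open ≡-Reasoning
  c′ = count n (tail Ω ∘ swapℕ j) (_<ᵇ Ω 0)
  c  = count n (tail Ω) (_<ᵇ Ω 0)
  d  = ⟦ isDescent Ω (suc (suc j)) ⟧
  a  = ⟦ isAscent Ω (suc (suc j)) ⟧

negInv-swap : ∀ n j Ω → suc j < n → negInv n (Ω ∘ swapℕ j) ≡ negInv n Ω
negInv-swap (suc (suc m)) zero Ω _ =
  trans (cong (λ z → ⟦ z ⟧ + c₁ + b₁ + (c₀ + b₀ + r)) (<ᵇ-neg (Ω 1) (Ω 0)))
        (rearrange ⟦ Ω 1 <ᵇ - Ω 0 ⟧ c₁ b₁ c₀ b₀ r)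
  where
  c₁ = count m (tail (tail Ω)) (_<ᵇ (- Ω 1))
  c₀ = count m (tail (tail Ω)) (_<ᵇ (- Ω 0))
  b₁ = ⟦ Ω 1 <ᵇ 0ℤ ⟧
  b₀ = ⟦ Ω 0 <ᵇ 0ℤ ⟧
  r  = negInv m (tail (tail Ω))
  rearrange : ∀ a c₁ b₁ c₀ b₀ r → a + c₁ + b₁ + (c₀ + b₀ + r) ≡ a + c₀ + b₀ + (c₁ + b₁ + r)
  rearrange = solve-∀
negInv-swap (suc n) (suc j) Ω (s≤s h) =
  cong₂ (λ c r → c + ⟦ Ω 0 <ᵇ 0ℤ ⟧ + r) (count-swap n j (tail Ω) _ h) (negInv-swap n j (tail Ω) h)

lengthB-negHead : ∀ n Ω →
  lengthB (suc n) (negHead Ω) + ⟦ isDescent Ω 0 ⟧ ≡ lengthB (suc n) Ω + ⟦ isAscent Ω 0 ⟧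
lengthB-negHead n Ω =
  trans (cong (λ z → c′ + r + (count n (tail Ω) (_<ᵇ z) + a + r′) + d) (ℤ.neg-involutive (Ω 0)))
        (rearrange c′ r c a r′ d)
  where
  c′ = count n (tail Ω) (_<ᵇ (- Ω 0))
  c  = count n (tail Ω) (_<ᵇ Ω 0)
  r  = inv n (tail Ω)
  r′ = negInv n (tail Ω)
  a  = ⟦ isAscent Ω 0 ⟧
  d  = ⟦ isDescent Ω 0 ⟧
  rearrange : ∀ c′ r c a r′ d → c′ + r + (c + a + r′) + d ≡ c + r + (c′ + d + r′) + a
  rearrange = solve-∀

-- Both brackets appear so that this holds for every window; for a signed
-- permutation exactly one of them is 1.
lengthB-act : ∀ n i Ω → i < n →
              lengthB n (act i Ω) + ⟦ isDescent Ω i ⟧ ≡ lengthB n Ω + ⟦ isAscent Ω i ⟧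
lengthB-act (suc n) zero    Ω _ = lengthB-negHead n Ω
lengthB-act n       (suc j) Ω h = begin
  inv n Ω′ + negInv n Ω′ + d ≡⟨ xy∙z≈xz∙y (inv n Ω′) _ d ⟩
  inv n Ω′ + d + negInv n Ω′ ≡⟨ cong₂ _+_ (inv-swap n j Ω h) (negInv-swap n j Ω h) ⟩
  inv n Ω + a + negInv n Ω   ≡⟨ xy∙z≈xz∙y (inv n Ω) a _ ⟩
  inv n Ω + negInv n Ω + a   ∎
  where
  open ≡-Reasoning
  Ω′ = Ω ∘ swapℕ j
  d  = ⟦ isDescent Ω (suc j) ⟧
  a  = ⟦ isAscent Ω (suc j) ⟧

descent⇒¬ascent : ∀ Ω i → isDescent Ω i ≡ true → isAscent Ω i ≡ false
descent⇒¬ascent Ω zero    d = <ᵇ-false (ℤ.<⇒≤ (ℤ.neg-mono-< (<ᵇ⇒< {Ω 0} d)))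
descent⇒¬ascent Ω (suc j) d = <ᵇ-false (ℤ.<⇒≤ (<ᵇ⇒< {Ω (suc j)} d))

ascent⇒¬descent : ∀ Ω i → isAscent Ω i ≡ true → isDescent Ω i ≡ false
ascent⇒¬descent Ω zero    a =
  <ᵇ-false (ℤ.<⇒≤ (subst (0ℤ <ℤ_) (ℤ.neg-involutive (Ω 0)) (ℤ.neg-mono-< (<ᵇ⇒< { - Ω 0} a))))
ascent⇒¬descent Ω (suc j) a = <ᵇ-false (ℤ.<⇒≤ (<ᵇ⇒< {Ω j} a))

lengthB-act-descent : ∀ n i Ω → i < n → isDescent Ω i ≡ true →
                      suc (lengthB n (act i Ω)) ≡ lengthB n Ω
lengthB-act-descent n i Ω i<n d = begin
  suc (lengthB n (act i Ω))                   ≡⟨ ℕ.+-comm 1 _ ⟩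
  lengthB n (act i Ω) + 1                     ≡⟨ cong (λ b → lengthB n (act i Ω) + ⟦ b ⟧) d ⟨
  lengthB n (act i Ω) + ⟦ isDescent Ω i ⟧     ≡⟨ lengthB-act n i Ω i<n ⟩
  lengthB n Ω + ⟦ isAscent Ω i ⟧              ≡⟨ cong (λ b → lengthB n Ω + ⟦ b ⟧) (descent⇒¬ascent Ω i d) ⟩
  lengthB n Ω + 0                             ≡⟨ ℕ.+-identityʳ _ ⟩
  lengthB n Ω                                 ∎
  where
  open ≡-Reasoning

lengthB-act-ascent : ∀ n i Ω → i < n → isAscent Ω i ≡ true →
                     lengthB n (act i Ω) ≡ suc (lengthB n Ω)
lengthB-act-ascent n i Ω i<n a = begin
  lengthB n (act i Ω)                         ≡⟨ ℕ.+-identityʳ _ ⟨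
  lengthB n (act i Ω) + 0                     ≡⟨ cong (λ b → lengthB n (act i Ω) + ⟦ b ⟧) (ascent⇒¬descent Ω i a) ⟨
  lengthB n (act i Ω) + ⟦ isDescent Ω i ⟧     ≡⟨ lengthB-act n i Ω i<n ⟩
  lengthB n Ω + ⟦ isAscent Ω i ⟧              ≡⟨ cong (λ b → lengthB n Ω + ⟦ b ⟧) a ⟩
  lengthB n Ω + 1                             ≡⟨ ℕ.+-comm _ 1 ⟩
  suc (lengthB n Ω)                           ∎
  where
  open ≡-Reasoning

lengthB-act≤ : ∀ n i Ω → i < n → lengthB n (act i Ω) ≤ suc (lengthB n Ω)
lengthB-act≤ n i Ω i<n = begin
  lengthB n (act i Ω)                      ≤⟨ ℕ.m≤m+n _ _ ⟩
  lengthB n (act i Ω) + ⟦ isDescent Ω i ⟧  ≡⟨ lengthB-act n i Ω i<n ⟩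
  lengthB n Ω + ⟦ isAscent Ω i ⟧           ≤⟨ ℕ.+-monoʳ-≤ (lengthB n Ω) (⟦⟧≤1 _) ⟩
  lengthB n Ω + 1                          ≡⟨ ℕ.+-comm _ 1 ⟩
  suc (lengthB n Ω)                        ∎
  where
  open ℕ.≤-Reasoning

lengthB-act>⇒¬descent : ∀ n i Ω → i < n → lengthB n Ω < lengthB n (act i Ω) → isDescent Ω i ≡ false
lengthB-act>⇒¬descent n i Ω i<n longer with isDescent Ω i in d
... | false = refl
... | true  = ⊥-elim (ℕ.<-asym longer (ℕ.≤-reflexive (lengthB-act-descent n i Ω i<n d)))

-- Bounding the inversion count

triangle : ℕ → ℕ
triangle zero    = 0
triangle (suc n) = n + triangle n

sumTo : ℕ → (ℕ → ℕ) → ℕ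
sumTo zero    f = 0
sumTo (suc n) f = f 0 + sumTo n (f ∘ suc)

count≤ : ∀ m v P → count m v P ≤ m
count≤ zero    v P = z≤n
count≤ (suc m) v P = ℕ.+-mono-≤ (⟦⟧≤1 (P (v 0))) (count≤ m (tail v) P)

count+gap≤ : ∀ m c v P → c ≤ m → (∀ t → t < c → P (v t) ≡ false) → count m v P + c ≤ m
count+gap≤ m       zero    v P _       _   = ℕ.≤-trans (ℕ.≤-reflexive (ℕ.+-identityʳ _)) (count≤ m v P)
count+gap≤ (suc m) (suc c) v P (s≤s c≤m) gap rewrite gap 0 (s≤s z≤n) =
  ℕ.≤-trans (ℕ.≤-reflexive (ℕ.+-suc _ c))
            (s≤s (count+gap≤ m c (tail v) P c≤m (λ t t<c → gap (suc t) (s≤s t<c))))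

≤count+gap : ∀ m c v P → (∀ t → c ≤ t → t < m → P (v t) ≡ true) → m ≤ count m v P + c
≤count+gap zero    c       v P all = z≤n
≤count+gap (suc m) zero    v P all rewrite all 0 z≤n (s≤s z≤n) =
  s≤s (≤count+gap m 0 (tail v) P (λ t _ t<m → all (suc t) z≤n (s≤s t<m)))
≤count+gap (suc m) (suc c) v P all = begin
  suc m                                   ≤⟨ s≤s (≤count+gap m c (tail v) P (λ t c≤t t<m → all (suc t) (s≤s c≤t) (s≤s t<m))) ⟩
  suc (count m (tail v) P + c)            ≡⟨ ℕ.+-suc _ c ⟨
  count m (tail v) P + suc c              ≤⟨ ℕ.+-monoˡ-≤ (suc c) (ℕ.m≤n+m _ ⟦ P (v 0) ⟧) ⟩
  count (suc m) v P + suc c               ∎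
  where open ℕ.≤-Reasoning

-- In the four bounds below, position k has no inversions with the r k
-- positions following it (upper bounds), or inversions with all later
-- positions except those r k (lower bounds).

inv+reach≤triangle : ∀ n Ω r → (∀ k → k < n → k + r k < n) →
                     (∀ k t → k < n → k < t → t ≤ k + r k → Ω k ≤ℤ Ω t) →
                     inv n Ω + sumTo n r ≤ triangle n
inv+reach≤triangle zero    Ω r _ _ = z≤n
inv+reach≤triangle (suc n) Ω r inside incr = begin
  (c + inv n (tail Ω)) + (r 0 + sumTo n (r ∘ suc)) ≡⟨ interchange c _ (r 0) _ ⟩
  (c + r 0) + (inv n (tail Ω) + sumTo n (r ∘ suc)) ≤⟨ ℕ.+-mono-≤ first rest ⟩
  n + triangle n                                    ∎
  where
  open ℕ.≤-Reasoning
  c = count n (tail Ω) (_<ᵇ Ω 0)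
  first : c + r 0 ≤ n
  first = count+gap≤ n (r 0) (tail Ω) _ (ℕ.≤-pred (inside 0 (s≤s z≤n)))
            (λ t t<r → <ᵇ-false (incr 0 (suc t) (s≤s z≤n) (s≤s z≤n) t<r))
  rest = inv+reach≤triangle n (tail Ω) (r ∘ suc) (λ k k<n → ℕ.≤-pred (inside (suc k) (s≤s k<n)))
           (λ k t k<n k<t t≤ → incr (suc k) (suc t) (s≤s k<n) (s≤s k<t) (s≤s t≤))

triangle≤inv+reach : ∀ n Ω r → (∀ k t → k + r k < t → t < n → Ω t <ℤ Ω k) →
                     triangle n ≤ inv n Ω + sumTo n r
triangle≤inv+reach zero    Ω r _ = z≤n
triangle≤inv+reach (suc n) Ω r decr = begin
  n + triangle n                                    ≤⟨ ℕ.+-mono-≤ first rest ⟩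
  (c + r 0) + (inv n (tail Ω) + sumTo n (r ∘ suc)) ≡⟨ interchange c (r 0) _ _ ⟩
  (c + inv n (tail Ω)) + (r 0 + sumTo n (r ∘ suc)) ∎
  where
  open ℕ.≤-Reasoning
  c = count n (tail Ω) (_<ᵇ Ω 0)
  first : n ≤ c + r 0
  first = ≤count+gap n (r 0) (tail Ω) _ (λ t r≤t t<n → <ᵇ-true (decr 0 (suc t) (s≤s r≤t) (s≤s t<n)))
  rest = triangle≤inv+reach n (tail Ω) (r ∘ suc) (λ k t k+r<t t<n → decr (suc k) (suc t) (s≤s k+r<t) (s≤s t<n))

negRow+reach≤ : ∀ n Ω ρ → ρ ≤ suc n → (∀ t → t < ρ → 0ℤ ≤ℤ Ω t) →
                count n (tail Ω) (_<ᵇ (- Ω 0)) + ⟦ Ω 0 <ᵇ 0ℤ ⟧ + ρ ≤ suc n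
negRow+reach≤ n Ω zero    _ _ = begin
  c + ⟦ Ω 0 <ᵇ 0ℤ ⟧ + 0 ≡⟨ ℕ.+-identityʳ _ ⟩
  c + ⟦ Ω 0 <ᵇ 0ℤ ⟧     ≤⟨ ℕ.+-mono-≤ (count≤ n (tail Ω) _) (⟦⟧≤1 _) ⟩
  n + 1                 ≡⟨ ℕ.+-comm n 1 ⟩
  suc n                 ∎
  where
  open ℕ.≤-Reasoning
  c = count n (tail Ω) (_<ᵇ (- Ω 0))
negRow+reach≤ n Ω (suc ρ) (s≤s ρ≤n) nonneg rewrite <ᵇ-false (nonneg 0 (s≤s z≤n)) = begin
  c + 0 + suc ρ   ≡⟨ cong (_+ suc ρ) (ℕ.+-identityʳ c) ⟩
  c + suc ρ       ≡⟨ ℕ.+-suc c ρ ⟩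
  suc (c + ρ)     ≤⟨ s≤s (count+gap≤ n ρ (tail Ω) _ ρ≤n noPair) ⟩
  suc n           ∎
  where
  open ℕ.≤-Reasoning
  c = count n (tail Ω) (_<ᵇ (- Ω 0))
  noPair : ∀ t → t < ρ → (Ω (suc t) <ᵇ - Ω 0) ≡ false
  noPair t t<ρ = <ᵇ-false (ℤ.≤-trans (ℤ.neg-mono-≤ (nonneg 0 (s≤s z≤n))) (nonneg (suc t) (s≤s t<ρ)))

≤negRow+reach : ∀ n Ω ρ → (ρ ≡ 0 → Ω 0 <ℤ 0ℤ) → (∀ t → ρ ≤ suc t → t < n → Ω (suc t) <ℤ - Ω 0) →
                suc n ≤ count n (tail Ω) (_<ᵇ (- Ω 0)) + ⟦ Ω 0 <ᵇ 0ℤ ⟧ + ρ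
≤negRow+reach n Ω zero    neg pairs rewrite <ᵇ-true (neg refl) = begin
  suc n           ≡⟨ ℕ.+-comm 1 n ⟩
  n + 1           ≤⟨ ℕ.+-monoˡ-≤ 1 (≤count+gap n 0 (tail Ω) _ (λ t _ t<n → <ᵇ-true (pairs t z≤n t<n))) ⟩
  c + 0 + 1       ≡⟨ cong (_+ 1) (ℕ.+-identityʳ c) ⟩
  c + 1           ≡⟨ ℕ.+-identityʳ _ ⟨
  c + 1 + 0       ∎
  where
  open ℕ.≤-Reasoning
  c = count n (tail Ω) (_<ᵇ (- Ω 0))
≤negRow+reach n Ω (suc ρ) neg pairs = begin
  suc n                     ≤⟨ s≤s (≤count+gap n ρ (tail Ω) _ (λ t ρ≤t t<n → <ᵇ-true (pairs t (s≤s ρ≤t) t<n))) ⟩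
  suc (c + ρ)               ≡⟨ ℕ.+-suc c ρ ⟨
  c + suc ρ                 ≤⟨ ℕ.+-monoˡ-≤ (suc ρ) (ℕ.m≤m+n c _) ⟩
  c + ⟦ Ω 0 <ᵇ 0ℤ ⟧ + suc ρ ∎
  where
  open ℕ.≤-Reasoning
  c = count n (tail Ω) (_<ᵇ (- Ω 0))

negInv+reach≤triangle : ∀ n Ω r → (∀ k → k < n → k + r k ≤ n) →
                        (∀ k t → k < n → k ≤ t → t < k + r k → 0ℤ ≤ℤ Ω t) →
                        negInv n Ω + sumTo n r ≤ triangle (suc n)
negInv+reach≤triangle zero    Ω r _ _ = z≤n
negInv+reach≤triangle (suc n) Ω r inside nonneg = begin
  (cb + negInv n (tail Ω)) + (r 0 + sumTo n (r ∘ suc)) ≡⟨ interchange cb _ (r 0) _ ⟩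
  (cb + r 0) + (negInv n (tail Ω) + sumTo n (r ∘ suc)) ≤⟨ ℕ.+-mono-≤ first rest ⟩
  suc n + triangle (suc n)                              ∎
  where
  open ℕ.≤-Reasoning
  cb = count n (tail Ω) (_<ᵇ (- Ω 0)) + ⟦ Ω 0 <ᵇ 0ℤ ⟧
  first = negRow+reach≤ n Ω (r 0) (inside 0 (s≤s z≤n)) (λ t t<r → nonneg 0 t (s≤s z≤n) z≤n t<r)
  rest = negInv+reach≤triangle n (tail Ω) (r ∘ suc) (λ k k<n → ℕ.≤-pred (inside (suc k) (s≤s k<n)))
           (λ k t k<n k≤t t< → nonneg (suc k) (suc t) (s≤s k<n) (s≤s k≤t) (s≤s t<))

triangle≤negInv+reach : ∀ n Ω r → (∀ k → k < n → r k ≡ 0 → Ω k <ℤ 0ℤ) →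
                        (∀ k t → k < t → k + r k ≤ t → t < n → Ω t <ℤ - Ω k) →
                        triangle (suc n) ≤ negInv n Ω + sumTo n r
triangle≤negInv+reach zero    Ω r _ _ = z≤n
triangle≤negInv+reach (suc n) Ω r neg pairs = begin
  suc n + triangle (suc n)                              ≤⟨ ℕ.+-mono-≤ first rest ⟩
  (cb + r 0) + (negInv n (tail Ω) + sumTo n (r ∘ suc)) ≡⟨ interchange cb (r 0) _ _ ⟩
  (cb + negInv n (tail Ω)) + (r 0 + sumTo n (r ∘ suc)) ∎
  where
  open ℕ.≤-Reasoning
  cb = count n (tail Ω) (_<ᵇ (- Ω 0)) + ⟦ Ω 0 <ᵇ 0ℤ ⟧
  first = ≤negRow+reach n Ω (r 0) (neg 0 (s≤s z≤n)) (λ t r≤t t<n → pairs 0 (suc t) (s≤s z≤n) r≤t (s≤s t<n))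
  rest = triangle≤negInv+reach n (tail Ω) (r ∘ suc) (λ k k<n → neg (suc k) (s≤s k<n))
           (λ k t k<t le t<n → pairs (suc k) (suc t) (s≤s k<t) (s≤s le) (s≤s t<n))

increasing⇒≤ : ∀ (Ω : ℕ → ℤ) k e → (∀ p → k ≤ p → p < e → Ω p ≤ℤ Ω (suc p)) →
               ∀ t → k ≤ t → t ≤ e → Ω k ≤ℤ Ω t
increasing⇒≤ Ω k e step zero    z≤n _ = ℤ.≤-refl
increasing⇒≤ Ω k e step (suc t) k≤t′ t<e with ℕ.m≤n⇒m<n∨m≡n k≤t′
... | inj₂ refl      = ℤ.≤-refl
... | inj₁ (s≤s k≤t) = ℤ.≤-trans (increasing⇒≤ Ω k e step t k≤t (ℕ.<⇒≤ t<e)) (step t k≤t t<e)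

sumTo-cong : ∀ m f g → (∀ i → i < m → f i ≡ g i) → sumTo m f ≡ sumTo m g
sumTo-cong zero    f g f≗g = refl
sumTo-cong (suc m) f g f≗g =
  cong₂ _+_ (f≗g 0 (s≤s z≤n)) (sumTo-cong m (f ∘ suc) (g ∘ suc) (λ i i<m → f≗g (suc i) (s≤s i<m)))

sumTo-+ : ∀ a b f → sumTo (a + b) f ≡ sumTo a f + sumTo b (λ i → f (a + i))
sumTo-+ zero    b f = refl
sumTo-+ (suc a) b f = trans (cong (f 0 +_) (sumTo-+ a b (f ∘ suc))) (sym (ℕ.+-assoc (f 0) _ _))

sumTo-zero : ∀ n f → (∀ k → f k ≡ 0) → sumTo n f ≡ 0
sumTo-zero zero    f f≗0 = refl
sumTo-zero (suc n) f f≗0 = cong₂ _+_ (f≗0 0) (sumTo-zero n (f ∘ suc) (f≗0 ∘ suc))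

sumTo-countdown : ∀ x → sumTo x (λ i → x ∸ suc i) ≡ triangle x
sumTo-countdown zero    = refl
sumTo-countdown (suc x) = cong (x +_) (sumTo-countdown x)

sumTo-truncated : ∀ x n → x ≤ n → sumTo n (x ∸_) ≡ triangle (suc x)
sumTo-truncated zero    n       _       = sumTo-zero n (0 ∸_) ℕ.0∸n≡0
sumTo-truncated (suc x) (suc n) (s≤s h) = cong (suc x +_) (sumTo-truncated x n h)

m+n≤n⇒m≡0 : ∀ {m} n → m + n ≤ n → m ≡ 0
m+n≤n⇒m≡0 {m} n h = ℕ.n≤0⇒n≡0 (ℕ.+-cancelʳ-≤ n m 0 h)

lengthB-no-descent : ∀ n Ω → (0 < n → 0ℤ ≤ℤ Ω 0) → (∀ p → suc p < n → Ω p ≤ℤ Ω (suc p)) →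
                     lengthB n Ω ≡ 0
lengthB-no-descent n Ω nonneg incr = cong₂ _+_ inv≡0 negInv≡0
  where
  inside : ∀ k → k < n → suc k + (n ∸ suc k) ≡ n
  inside k k<n = ℕ.m+[n∸m]≡n k<n
  chain : ∀ k t → k ≤ t → suc t ≤ n → Ω k ≤ℤ Ω t
  chain k t k≤t t<n = increasing⇒≤ Ω k t (λ p _ p<t → incr p (ℕ.<-≤-trans (s≤s p<t) t<n)) t k≤t ℕ.≤-refl
  inv≡0 : inv n Ω ≡ 0
  inv≡0 = m+n≤n⇒m≡0 (triangle n) (subst (λ s → inv n Ω + s ≤ triangle n) (sumTo-countdown n)
    (inv+reach≤triangle n Ω (λ k → n ∸ suc k)
      (λ k k<n → ℕ.≤-reflexive (inside k k<n))
      (λ k t k<n k<t t≤ → chain k t (ℕ.<⇒≤ k<t) (ℕ.≤-trans (s≤s t≤) (ℕ.≤-reflexive (inside k k<n))))))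
  negInv≡0 : negInv n Ω ≡ 0
  negInv≡0 = m+n≤n⇒m≡0 (triangle (suc n))
    (subst (λ s → negInv n Ω + s ≤ triangle (suc n)) (sumTo-truncated n n ℕ.≤-refl)
    (negInv+reach≤triangle n Ω (n ∸_)
      (λ k k<n → ℕ.≤-reflexive (ℕ.m+[n∸m]≡n (ℕ.<⇒≤ k<n)))
      (λ k t k<n _ t< → ℤ.≤-trans (nonneg (ℕ.≤-<-trans z≤n k<n))
                                   (chain 0 t z≤n (ℕ.<-≤-trans t< (ℕ.≤-reflexive (ℕ.m+[n∸m]≡n (ℕ.<⇒≤ k<n))))))))

-- Signed permutations and their length

Odd : ∀ {n} → (SFin n → SFin n) → Set
Odd f = ∀ a → f (neg a) ≡ neg (f a)

Injective : ∀ {n} → (SFin n → SFin n) → Set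
Injective f = ∀ a b → f a ≡ f b → a ≡ b

signed : Bool → ℕ → ℤ
signed false k = +[1+ k ]
signed true  k = -[1+ k ]

toℤ : ∀ {n} → SFin n → ℤ
toℤ (b , a) = signed b (toℕ a)

toℤ-neg : ∀ {n} (s : SFin n) → toℤ (neg s) ≡ - toℤ s
toℤ-neg (false , a) = refl
toℤ-neg (true  , a) = refl

toℤ-injective : ∀ {n} (s t : SFin n) → toℤ s ≡ toℤ t → s ≡ t
toℤ-injective (false , a) (false , b) e = cong (false ,_) (toℕ-injective (ℕ.suc-injective (ℤ.+-injective e)))
toℤ-injective (true  , a) (true  , b) e = cong (true ,_) (toℕ-injective (ℤ.-[1+-injective e))
toℤ-injective (false , a) (true  , b) ()
toℤ-injective (true  , a) (false , b) ()

-- Padded with zeros beyond position n, so that windows live on ℕ.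
windowAt : ∀ n → (Fin n → ℤ) → ℕ → ℤ
windowAt zero    g k       = 0ℤ
windowAt (suc n) g zero    = g zero
windowAt (suc n) g (suc k) = windowAt n (g ∘ suc) k

windowAt-cong : ∀ n {g h : Fin n → ℤ} → (∀ a → g a ≡ h a) → ∀ k → windowAt n g k ≡ windowAt n h k
windowAt-cong zero    g≗h k       = refl
windowAt-cong (suc n) g≗h zero    = g≗h zero
windowAt-cong (suc n) g≗h (suc k) = windowAt-cong n (g≗h ∘ suc) k

windowAt-toℕ : ∀ n (g : Fin n → ℤ) a → windowAt n g (toℕ a) ≡ g a
windowAt-toℕ (suc n) g zero    = refl
windowAt-toℕ (suc n) g (suc a) = windowAt-toℕ n (g ∘ suc) a

windowAt-beyond : ∀ n (g : Fin n → ℤ) k → n ≤ k → windowAt n g k ≡ 0ℤ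
windowAt-beyond zero    g k       _       = refl
windowAt-beyond (suc n) g (suc k) (s≤s h) = windowAt-beyond n (g ∘ suc) k h

window : ∀ {n} → (SFin n → SFin n) → ℕ → ℤ
window {n} f = windowAt n (λ a → toℤ (f (false , a)))

window-fromℕ< : ∀ {n} (f : SFin n → SFin n) p (p<n : p < n) → window f p ≡ toℤ (f (false , fromℕ< p<n))
window-fromℕ< {n} f p p<n = trans (cong (window f) (sym (toℕ-fromℕ< p<n))) (windowAt-toℕ n _ _)

ℓ : ∀ {n} → (SFin n → SFin n) → ℕ
ℓ {n} f = lengthB n (window f)

ℓ-cong : ∀ {n} {f g : SFin n → SFin n} → f ≈ g → ℓ f ≡ ℓ g
ℓ-cong {n} f≈g = lengthB-cong n (windowAt-cong n (λ a → cong toℤ (f≈g (false , a))))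

swapFin-left : ∀ {n} (i j : Fin n) → swapFin i j i ≡ j
swapFin-left i j rewrite dec-true (i ≟ᶠ i) refl = refl

swapFin-right : ∀ {n} (i j : Fin n) → swapFin i j j ≡ i
swapFin-right i j with j ≟ᶠ i
... | yes j≡i = j≡i
... | no  _   rewrite dec-true (j ≟ᶠ j) refl = refl

swapFin-other : ∀ {n} (i j a : Fin n) → a ≢ i → a ≢ j → swapFin i j a ≡ a
swapFin-other i j a a≢i a≢j rewrite dec-false (a ≟ᶠ i) a≢i | dec-false (a ≟ᶠ j) a≢j = refl

swapFin-involutive : ∀ {n} (i j a : Fin n) → swapFin i j (swapFin i j a) ≡ a
swapFin-involutive i j a with a ≟ᶠ i
... | yes refl = swapFin-right i j
... | no a≢i with a ≟ᶠ j
...   | yes refl = swapFin-left i j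
...   | no  a≢j  = swapFin-other i j a a≢i a≢j

swapℕ-left : ∀ m → swapℕ m m ≡ suc m
swapℕ-left zero    = refl
swapℕ-left (suc m) = cong suc (swapℕ-left m)

swapℕ-right : ∀ m → swapℕ m (suc m) ≡ m
swapℕ-right zero    = refl
swapℕ-right (suc m) = cong suc (swapℕ-right m)

swapℕ-other : ∀ m k → k ≢ m → k ≢ suc m → swapℕ m k ≡ k
swapℕ-other zero    zero          k≢m _     = ⊥-elim (k≢m refl)
swapℕ-other zero    (suc zero)    _   k≢1+m = ⊥-elim (k≢1+m refl)
swapℕ-other zero    (suc (suc k)) _   _     = refl
swapℕ-other (suc m) zero          _   _     = refl
swapℕ-other (suc m) (suc k) k≢m k≢1+m = cong suc (swapℕ-other m k (k≢m ∘ cong suc) (k≢1+m ∘ cong suc))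

toℕ-swapFin : ∀ {n} (j : Fin n) (a : Fin (suc n)) →
              toℕ (swapFin (inject₁ j) (suc j) a) ≡ swapℕ (toℕ j) (toℕ a)
toℕ-swapFin j a with a ≟ᶠ inject₁ j
... | yes refl rewrite toℕ-inject₁ j = sym (swapℕ-left (toℕ j))
... | no a≢j with a ≟ᶠ suc j
...   | yes refl rewrite toℕ-inject₁ j = sym (swapℕ-right (toℕ j))
...   | no  a≢1+j = sym (swapℕ-other (toℕ j) (toℕ a)
                          (λ e → a≢j (toℕ-injective (trans e (sym (toℕ-inject₁ j)))))
                          (λ e → a≢1+j (toℕ-injective e)))

windowAt-swap : ∀ {n} (g : Fin (suc n) → ℤ) (j : Fin n) k →
                windowAt (suc n) (g ∘ swapFin (inject₁ j) (suc j)) k ≡ windowAt (suc n) g (swapℕ (toℕ j) k)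
windowAt-swap {n} g j k with k ℕ.<? suc n
... | yes k<n = begin
  windowAt (suc n) (g ∘ σ) k                       ≡⟨ cong (windowAt (suc n) (g ∘ σ)) (toℕ-fromℕ< k<n) ⟨
  windowAt (suc n) (g ∘ σ) (toℕ a)                 ≡⟨ windowAt-toℕ (suc n) (g ∘ σ) a ⟩
  g (σ a)                                          ≡⟨ windowAt-toℕ (suc n) g (σ a) ⟨
  windowAt (suc n) g (toℕ (σ a))                   ≡⟨ cong (windowAt (suc n) g) (toℕ-swapFin j a) ⟩
  windowAt (suc n) g (swapℕ (toℕ j) (toℕ a))       ≡⟨ cong (windowAt (suc n) g ∘ swapℕ (toℕ j)) (toℕ-fromℕ< k<n) ⟩
  windowAt (suc n) g (swapℕ (toℕ j) k)             ∎
  where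
  open ≡-Reasoning
  σ = swapFin (inject₁ j) (suc j)
  a = fromℕ< k<n
... | no k≮n = begin
  windowAt (suc n) (g ∘ swapFin (inject₁ j) (suc j)) k ≡⟨ windowAt-beyond (suc n) _ k n≤k ⟩
  0ℤ                                                   ≡⟨ windowAt-beyond (suc n) g k n≤k ⟨
  windowAt (suc n) g k                                 ≡⟨ cong (windowAt (suc n) g) (swapℕ-other (toℕ j) k k≢j k≢1+j) ⟨
  windowAt (suc n) g (swapℕ (toℕ j) k)                 ∎
  where
  open ≡-Reasoning
  n≤k = ℕ.≮⇒≥ k≮n
  k≢j : k ≢ toℕ j
  k≢j refl = k≮n (ℕ.<-trans (toℕ<n j) (ℕ.n<1+n n))
  k≢1+j : k ≢ suc (toℕ j)
  k≢1+j refl = k≮n (s≤s (toℕ<n j))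

window-gen : ∀ {n} (f : SFin n → SFin n) → Odd f → ∀ (i : Fin n) k →
             window (f ∘ gen i) k ≡ act (toℕ i) (window f) k
window-gen f odd zero    zero    = trans (cong toℤ (odd (false , zero))) (toℤ-neg (f (false , zero)))
window-gen f odd zero    (suc k) = refl
window-gen f odd (suc j) k       = windowAt-swap (λ a → toℤ (f (false , a))) j k

ℓ-gen : ∀ {n} (f : SFin n → SFin n) → Odd f → ∀ (i : Fin n) →
        ℓ (f ∘ gen i) ≡ lengthB n (act (toℕ i) (window f))
ℓ-gen {n} f odd i = lengthB-cong n (window-gen f odd i)

gen-odd : ∀ {n} (i : Fin n) → Odd (gen i)
gen-odd zero    (b , zero)  = refl
gen-odd zero    (b , suc a) = refl
gen-odd (suc j) (b , a)     = refl

gen-involutive : ∀ {n} (i : Fin n) a → gen i (gen i a) ≡ a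
gen-involutive zero    (b , zero)  = cong (_, zero) (not-involutive b)
gen-involutive zero    (b , suc a) = refl
gen-involutive (suc j) (b , a)     = cong (b ,_) (swapFin-involutive (inject₁ j) (suc j) a)

gen-injective : ∀ {n} (i : Fin n) → Injective (gen i)
gen-injective i a b e = trans (sym (gen-involutive i a)) (trans (cong (gen i) e) (gen-involutive i b))

odd-∘ : ∀ {n} {f g : SFin n → SFin n} → Odd f → Odd g → Odd (f ∘ g)
odd-∘ {f = f} {g} f-odd g-odd a = trans (cong f (g-odd a)) (f-odd (g a))

injective-∘ : ∀ {n} {f g : SFin n → SFin n} → Injective f → Injective g → Injective (f ∘ g)
injective-∘ f-inj g-inj a b e = g-inj a b (f-inj _ _ e)

evalWord-snoc : ∀ {n} (ws : List (Fin n)) i a → evalWord (ws ++ i ∷ []) a ≡ evalWord ws (gen i a)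
evalWord-snoc []       i a = refl
evalWord-snoc (x ∷ ws) i a = cong (gen x) (evalWord-snoc ws i a)

ℓ-gen≤ : ∀ {n} (f : SFin n → SFin n) → Odd f → ∀ i → ℓ (f ∘ gen i) ≤ suc (ℓ f)
ℓ-gen≤ {n} f odd i = subst (_≤ suc (ℓ f)) (sym (ℓ-gen f odd i)) (lengthB-act≤ n (toℕ i) (window f) (toℕ<n i))

ℓ-∘-evalWord : ∀ {n} (f : SFin n → SFin n) → Odd f → ∀ ws → ℓ (f ∘ evalWord ws) ≤ ℓ f + length ws
ℓ-∘-evalWord f odd []       = ℕ.m≤m+n (ℓ f) 0
ℓ-∘-evalWord f odd (i ∷ ws) = begin
  ℓ (f ∘ gen i ∘ evalWord ws)  ≤⟨ ℓ-∘-evalWord (f ∘ gen i) (odd-∘ {f = f} odd (gen-odd i)) ws ⟩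
  ℓ (f ∘ gen i) + length ws    ≤⟨ ℕ.+-monoˡ-≤ (length ws) (ℓ-gen≤ f odd i) ⟩
  suc (ℓ f) + length ws        ≡⟨ ℕ.+-suc (ℓ f) (length ws) ⟨
  ℓ f + suc (length ws)        ∎
  where open ℕ.≤-Reasoning

window-id : ∀ {n} p → p < n → window {n} id p ≡ +[1+ p ]
window-id p p<n = trans (window-fromℕ< id p p<n) (cong +[1+_] (toℕ-fromℕ< p<n))

ℓ-id : ∀ {n} → ℓ {n} id ≡ 0
ℓ-id {n} = lengthB-no-descent n (window {n} id)
  (λ 0<n → subst (0ℤ ≤ℤ_) (sym (window-id {n} 0 0<n)) (+≤+ z≤n))
  (λ p 1+p<n → subst₂ _≤ℤ_ (sym (window-id {n} p (ℕ.<-trans (ℕ.n<1+n p) 1+p<n))) (sym (window-id {n} (suc p) 1+p<n))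
                           (+≤+ (ℕ.n≤1+n (suc p))))

ℓ≤length : ∀ {n} (ws : List (Fin n)) f → evalWord ws ≈ f → ℓ f ≤ length ws
ℓ≤length {n} ws f eval≈f = begin
  ℓ f                  ≡⟨ ℓ-cong eval≈f ⟨
  ℓ (id ∘ evalWord ws) ≤⟨ ℓ-∘-evalWord id (λ _ → refl) ws ⟩
  ℓ {n} id + length ws ≡⟨ cong (_+ length ws) (ℓ-id {n}) ⟩
  length ws            ∎
  where open ℕ.≤-Reasoning

NoDescent : ∀ n → (ℕ → ℤ) → Set
NoDescent n Ω = ∀ (i : Fin n) → isDescent Ω (toℕ i) ≡ false

noDescent⇒0≤head : ∀ n Ω → NoDescent n Ω → 0 < n → 0ℤ ≤ℤ Ω 0
noDescent⇒0≤head n Ω none 0<n =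
  <ᵇ-false⇒≥ {Ω 0} (subst (λ k → isDescent Ω k ≡ false) (toℕ-fromℕ< 0<n) (none (fromℕ< 0<n)))

noDescent⇒increasing : ∀ n Ω → NoDescent n Ω → ∀ p → suc p < n → Ω p ≤ℤ Ω (suc p)
noDescent⇒increasing n Ω none p 1+p<n =
  <ᵇ-false⇒≥ {Ω (suc p)} (subst (λ k → isDescent Ω k ≡ false) (toℕ-fromℕ< 1+p<n) (none (fromℕ< 1+p<n)))

descent-exists : ∀ n Ω → 0 < lengthB n Ω → ∃ λ (i : Fin n) → isDescent Ω (toℕ i) ≡ true
descent-exists n Ω pos with any? (λ i → isDescent Ω (toℕ i) ≟ᵇ true)
... | yes descent = descent
... | no ¬descent = ⊥-elim (ℕ.<-irrefl (sym (lengthB-no-descent n Ω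
                      (noDescent⇒0≤head n Ω none) (noDescent⇒increasing n Ω none))) pos)
  where
  none : NoDescent n Ω
  none i = ¬-not (λ d → ¬descent (i , d))

ℓ-descent : ∀ {n} (f : SFin n → SFin n) → Odd f → 0 < ℓ f → ∃ λ (i : Fin n) → suc (ℓ (f ∘ gen i)) ≡ ℓ f
ℓ-descent {n} f odd pos with descent-exists n (window f) pos
... | i , d = i , trans (cong suc (ℓ-gen f odd i)) (lengthB-act-descent n (toℕ i) (window f) (toℕ<n i) d)

ℓ≡0⇒noDescent : ∀ {n} (f : SFin n → SFin n) → Odd f → ℓ f ≡ 0 → NoDescent n (window f)
ℓ≡0⇒noDescent {n} f odd ℓ≡0 i with isDescent (window f) (toℕ i) in d
... | false = refl
... | true  = ⊥-elim (ℕ.1+n≢0 (trans (trans (cong suc (ℓ-gen f odd i))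
                        (lengthB-act-descent n (toℕ i) (window f) (toℕ<n i) d)) ℓ≡0))

strictlyIncreasing⇒≡suc : ∀ n (U : ℕ → ℕ) → (∀ p → p < n → 1 ≤ U p × U p ≤ n) →
                          (∀ p → suc p < n → U p < U (suc p)) → ∀ p → p < n → U p ≡ suc p
strictlyIncreasing⇒≡suc n U bounded incr p p<n = ℕ.≤-antisym U≤ ≤U
  where
  from-start : ∀ p → p < n → suc p ≤ U p
  from-start zero    p<n = proj₁ (bounded 0 p<n)
  from-start (suc p) p<n = ℕ.≤-trans (s≤s (from-start p (ℕ.<-trans (ℕ.n<1+n p) p<n))) (incr p p<n)
  gap : ∀ d → p + d < n → U p + d ≤ U (p + d)
  gap zero    _ = ℕ.≤-reflexive (trans (ℕ.+-identityʳ _) (cong U (sym (ℕ.+-identityʳ p))))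
  gap (suc d) h = begin
    U p + suc d      ≡⟨ ℕ.+-suc (U p) d ⟩
    suc (U p + d)    ≤⟨ s≤s (gap d (ℕ.<-trans (ℕ.+-monoʳ-< p (ℕ.n<1+n d)) h)) ⟩
    suc (U (p + d))  ≤⟨ incr (p + d) (subst (_< n) (ℕ.+-suc p d) h) ⟩
    U (suc (p + d))  ≡⟨ cong U (ℕ.+-suc p d) ⟨
    U (p + suc d)    ∎
    where open ℕ.≤-Reasoning
  d = n ∸ suc p
  p+d<n : p + d < n
  p+d<n = ℕ.≤-reflexive (ℕ.m+[n∸m]≡n p<n)
  U≤ : U p ≤ suc p
  U≤ = ℕ.+-cancelʳ-≤ d (U p) (suc p) (begin
    U p + d          ≤⟨ gap d p+d<n ⟩
    U (p + d)        ≤⟨ proj₂ (bounded (p + d) p+d<n) ⟩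
    n                ≡⟨ ℕ.m+[n∸m]≡n p<n ⟨
    suc p + d        ∎)
    where open ℕ.≤-Reasoning
  ≤U = from-start p p<n

∣∣-mono-< : ∀ {i j} → 0ℤ ≤ℤ i → i <ℤ j → ∣ i ∣ < ∣ j ∣
∣∣-mono-< (+≤+ _) (+<+ m<n) = m<n

∣toℤ∣ : ∀ {n} (s : SFin n) → ∣ toℤ s ∣ ≡ suc (toℕ (proj₂ s))
∣toℤ∣ (false , a) = refl
∣toℤ∣ (true  , a) = refl

0≤toℤ⇒positive : ∀ {n} (s : SFin n) → 0ℤ ≤ℤ toℤ s → s ≡ (false , proj₂ s)
0≤toℤ⇒positive (false , a) _ = refl

noDescent⇒nonneg : ∀ n Ω → NoDescent n Ω → ∀ p → p < n → 0ℤ ≤ℤ Ω p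
noDescent⇒nonneg n Ω none p p<n = ℤ.≤-trans (noDescent⇒0≤head n Ω none (ℕ.≤-<-trans z≤n p<n))
  (increasing⇒≤ Ω 0 p (λ q _ q<p → noDescent⇒increasing n Ω none q (ℕ.<-≤-trans (s≤s q<p) p<n)) p z≤n ℕ.≤-refl)

window-injective : ∀ {n} (f : SFin n → SFin n) → Injective f →
                   ∀ p q (p<n : p < n) (q<n : q < n) → window f p ≡ window f q → p ≡ q
window-injective f inj p q p<n q<n same = begin
  p                  ≡⟨ toℕ-fromℕ< p<n ⟨
  toℕ (fromℕ< p<n)   ≡⟨ cong (toℕ ∘ proj₂) (inj _ _ (toℤ-injective _ _ images)) ⟩
  toℕ (fromℕ< q<n)   ≡⟨ toℕ-fromℕ< q<n ⟩
  q                  ∎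
  where
  open ≡-Reasoning
  images = trans (sym (window-fromℕ< f p p<n)) (trans same (window-fromℕ< f q q<n))

-- A signed permutation with no descent has a nonnegative increasing
-- window, which must then be 1, 2, …, n.
ℓ≡0⇒≈id : ∀ {n} (f : SFin n → SFin n) → Odd f → Injective f → ℓ f ≡ 0 → f ≈ id
ℓ≡0⇒≈id {n} f odd inj ℓ≡0 = fixes
  where
  Ω = window f
  none = ℓ≡0⇒noDescent f odd ℓ≡0
  U : ℕ → ℕ
  U p = ∣ Ω p ∣
  bounded : ∀ p → p < n → 1 ≤ U p × U p ≤ n
  bounded p p<n rewrite window-fromℕ< f p p<n | ∣toℤ∣ (f (false , fromℕ< p<n)) = s≤s z≤n , toℕ<n _
  increasing : ∀ p → suc p < n → U p < U (suc p)
  increasing p 1+p<n = ∣∣-mono-< (noDescent⇒nonneg n Ω none p p<n)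
    (ℤ.≤∧≢⇒< (noDescent⇒increasing n Ω none p 1+p<n)
             (ℕ.1+n≢n ∘ sym ∘ window-injective f inj p (suc p) p<n 1+p<n))
    where
    p<n = ℕ.<-trans (ℕ.n<1+n p) 1+p<n
  fixes : ∀ s → f s ≡ s
  fixes (false , a) =
    trans (0≤toℤ⇒positive (f (false , a)) (subst (0ℤ ≤ℤ_) Ωa (noDescent⇒nonneg n Ω none (toℕ a) (toℕ<n a))))
          (cong (false ,_) (toℕ-injective (ℕ.suc-injective (begin
    suc (toℕ (proj₂ (f (false , a)))) ≡⟨ ∣toℤ∣ (f (false , a)) ⟨
    ∣ toℤ (f (false , a)) ∣           ≡⟨ cong ∣_∣ Ωa ⟨
    U (toℕ a)                         ≡⟨ strictlyIncreasing⇒≡suc n U bounded increasing (toℕ a) (toℕ<n a) ⟩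
    suc (toℕ a)                       ∎))))
    where
    open ≡-Reasoning
    Ωa : Ω (toℕ a) ≡ toℤ (f (false , a))
    Ωa = windowAt-toℕ n _ a
  fixes (true , a) = trans (odd (false , a)) (cong neg (fixes (false , a)))

reducedWord : ∀ k {n} (f : SFin n → SFin n) → Odd f → Injective f → ℓ f ≡ k →
              Σ (List (Fin n)) λ ws → length ws ≡ k × evalWord ws ≈ f
reducedWord zero    f odd inj ℓ≡0 = [] , refl , λ a → sym (ℓ≡0⇒≈id f odd inj ℓ≡0 a)
reducedWord (suc k) f odd inj ℓ≡1+k with ℓ-descent f odd (subst (0 <_) (sym ℓ≡1+k) (s≤s z≤n))
... | i , down with reducedWord k (f ∘ gen i) (odd-∘ {f = f} odd (gen-odd i))
                      (injective-∘ {f = f} inj (gen-injective i)) (ℕ.suc-injective (trans down ℓ≡1+k))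
...   | ws , len , eval =
  ws ++ i ∷ [] ,
  trans (List.length-++ ws) (trans (ℕ.+-comm _ 1) (cong suc len)) ,
  λ a → trans (evalWord-snoc ws i a) (trans (eval (gen i a)) (cong f (gen-involutive i a)))

hasLength-ℓ : ∀ {n} (f : SFin n → SFin n) → Odd f → Injective f → HasLength f (ℓ f)
hasLength-ℓ f odd inj = reducedWord (ℓ f) f odd inj refl , λ ws eval → ℓ≤length ws f eval

hasLength-unique : ∀ {n} {f : SFin n → SFin n} {k m} → HasLength f k → HasLength f m → k ≡ m
hasLength-unique ((ws , len , eval) , k-min) ((ws′ , len′ , eval′) , m-min) =
  ℕ.≤-antisym (subst (_ ≤_) len′ (k-min ws′ eval′)) (subst (_ ≤_) len (m-min ws eval))

hyp-injective : ∀ {n} (w : Hyp n) → Injective (fun w)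
hyp-injective w a b e = begin
  a                         ≡⟨ strictlyInverseʳ a ⟨
  from (fun w a)            ≡⟨ cong from e ⟩
  from (fun w b)            ≡⟨ strictlyInverseʳ b ⟩
  b                         ∎
  where
  open ≡-Reasoning
  open Inverse (perm w) using (from; strictlyInverseʳ)

ℓ-ascent : ∀ {n} (f : SFin n → SFin n) → Odd f → ∀ i → isAscent (window f) (toℕ i) ≡ true →
           ℓ (f ∘ gen i) ≡ suc (ℓ f)
ℓ-ascent {n} f odd i up = trans (ℓ-gen f odd i) (lengthB-act-ascent n (toℕ i) (window f) (toℕ<n i) up)

ℓ-gen>⇒¬descent : ∀ {n} (f : SFin n → SFin n) → Odd f → ∀ i → ℓ f < ℓ (f ∘ gen i) →
                  isDescent (window f) (toℕ i) ≡ false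
ℓ-gen>⇒¬descent {n} f odd i longer =
  lengthB-act>⇒¬descent n (toℕ i) (window f) (toℕ<n i) (subst (ℓ f <_) (ℓ-gen f odd i) longer)

hasLength-ℓ∘gen : ∀ {n} (f : SFin n → SFin n) → Odd f → Injective f → ∀ i →
                  HasLength (f ∘ gen i) (ℓ (f ∘ gen i))
hasLength-ℓ∘gen f odd inj i =
  hasLength-ℓ (f ∘ gen i) (odd-∘ {f = f} odd (gen-odd i)) (injective-∘ {f = f} inj (gen-injective i))

-- Blocks of a composition

-- The blocks of xs laid end to end from position acc: blockEnd acc xs o is
-- the end of the block containing o, and blockRev acc xs reverses each block.

blockEnd : ℕ → List ℕ → ℕ → ℕ
blockEnd acc []       o = suc o
blockEnd acc (x ∷ xs) o = if does (o ℕ.<? acc + x) then acc + x else blockEnd (acc + x) xs o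

blockRev : ℕ → List ℕ → ℕ → ℕ
blockRev acc []       p = p
blockRev acc (x ∷ xs) p = if does (p ℕ.<? acc + x) then acc + (acc + x ∸ suc p) else blockRev (acc + x) xs p

blockEnd-here : ∀ acc x xs o → o < acc + x → blockEnd acc (x ∷ xs) o ≡ acc + x
blockEnd-here acc x xs o h rewrite dec-true (o ℕ.<? acc + x) h = refl

blockEnd-later : ∀ acc x xs o → ¬ (o < acc + x) → blockEnd acc (x ∷ xs) o ≡ blockEnd (acc + x) xs o
blockEnd-later acc x xs o h rewrite dec-false (o ℕ.<? acc + x) h = refl

blockRev-here : ∀ acc x xs o → o < acc + x → blockRev acc (x ∷ xs) o ≡ acc + (acc + x ∸ suc o)
blockRev-here acc x xs o h rewrite dec-true (o ℕ.<? acc + x) h = refl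

blockRev-later : ∀ acc x xs o → ¬ (o < acc + x) → blockRev acc (x ∷ xs) o ≡ blockRev (acc + x) xs o
blockRev-later acc x xs o h rewrite dec-false (o ℕ.<? acc + x) h = refl

blockEnd-bounds : ∀ acc xs o → o < acc + sum xs → o < blockEnd acc xs o × blockEnd acc xs o ≤ acc + sum xs
blockEnd-bounds acc []       o o<end = ℕ.n<1+n o , o<end
blockEnd-bounds acc (x ∷ xs) o o<end with o ℕ.<? acc + x
... | yes here′ = subst (λ e → o < e × e ≤ acc + sum (x ∷ xs)) (sym (blockEnd-here acc x xs o here′))
                    (here′ , ℕ.+-monoʳ-≤ acc (ℕ.m≤m+n x (sum xs)))
... | no later = subst (λ e → o < e × e ≤ acc + sum (x ∷ xs)) (sym (blockEnd-later acc x xs o later))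
                   (proj₁ rest , ℕ.≤-trans (proj₂ rest) (ℕ.≤-reflexive (ℕ.+-assoc acc x (sum xs))))
  where
  rest = blockEnd-bounds (acc + x) xs o (subst (o <_) (sym (ℕ.+-assoc acc x (sum xs))) o<end)

psumsFrom-≥ : ∀ acc x xs e → e ∈ psumsFrom acc (x ∷ xs) → acc + x ≤ e
psumsFrom-≥ acc x [] e ()
psumsFrom-≥ acc x (y ∷ ys) e (here refl) = ℕ.≤-refl
psumsFrom-≥ acc x (y ∷ ys) e (there m) = ℕ.≤-trans (ℕ.m≤m+n (acc + x) y) (psumsFrom-≥ (acc + x) y ys e m)

¬boundary<blockEnd : ∀ acc xs k p → k ≤ p → suc p < blockEnd acc xs k → suc p ∉ psumsFrom acc xs
¬boundary<blockEnd acc [] k p k≤p 1+p<end = ⊥-elim (ℕ.<-irrefl refl (ℕ.<-≤-trans 1+p<end (s≤s k≤p)))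
¬boundary<blockEnd acc (x ∷ xs) k p k≤p 1+p<end boundary with k ℕ.<? acc + x
... | yes here′ = ℕ.<-irrefl refl (ℕ.<-≤-trans (subst (suc p <_) (blockEnd-here acc x xs k here′) 1+p<end)
                                                (psumsFrom-≥ acc x xs (suc p) boundary))
¬boundary<blockEnd acc (x ∷ [])     k p k≤p 1+p<end ()             | no later
¬boundary<blockEnd acc (x ∷ y ∷ ys) k p k≤p 1+p<end (here 1+p≡x)   | no later =
  later (ℕ.<-≤-trans (s≤s k≤p) (ℕ.≤-reflexive 1+p≡x))
¬boundary<blockEnd acc (x ∷ y ∷ ys) k p k≤p 1+p<end (there boundary) | no later =
  ¬boundary<blockEnd (acc + x) (y ∷ ys) k p k≤p (subst (suc p <_) (blockEnd-later acc x (y ∷ ys) k later) 1+p<end) boundary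

sumTo-blockReach : ∀ acc xs → sumTo (sum xs) (λ i → blockEnd acc xs (acc + i) ∸ suc (acc + i)) ≡ sum (map triangle xs)
sumTo-blockReach acc []       = refl
sumTo-blockReach acc (x ∷ xs) = trans (sumTo-+ x (sum xs) _) (cong₂ _+_ first rest)
  where
  first : sumTo x (λ i → blockEnd acc (x ∷ xs) (acc + i) ∸ suc (acc + i)) ≡ triangle x
  first = trans (sumTo-cong x _ _ reach) (sumTo-countdown x)
    where
    reach : ∀ i → i < x → blockEnd acc (x ∷ xs) (acc + i) ∸ suc (acc + i) ≡ x ∸ suc i
    reach i i<x = begin
      blockEnd acc (x ∷ xs) (acc + i) ∸ suc (acc + i) ≡⟨ cong (_∸ suc (acc + i)) (blockEnd-here acc x xs (acc + i) (ℕ.+-monoʳ-< acc i<x)) ⟩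
      acc + x ∸ suc (acc + i)                         ≡⟨ cong (acc + x ∸_) (ℕ.+-suc acc i) ⟨
      acc + x ∸ (acc + suc i)                         ≡⟨ ℕ.[m+n]∸[m+o]≡n∸o acc x (suc i) ⟩
      x ∸ suc i                                       ∎
      where open ≡-Reasoning
  rest : sumTo (sum xs) (λ i → blockEnd acc (x ∷ xs) (acc + (x + i)) ∸ suc (acc + (x + i))) ≡ sum (map triangle xs)
  rest = trans (sumTo-cong (sum xs) _ _ later) (sumTo-blockReach (acc + x) xs)
    where
    later : ∀ i → i < sum xs → blockEnd acc (x ∷ xs) (acc + (x + i)) ∸ suc (acc + (x + i))
                             ≡ blockEnd (acc + x) xs (acc + x + i) ∸ suc (acc + x + i)
    later i _ rewrite sym (ℕ.+-assoc acc x i) =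
      cong (_∸ suc (acc + x + i)) (blockEnd-later acc x xs (acc + x + i) (ℕ.≤⇒≯ (ℕ.m≤m+n (acc + x) i)))

inBlock : ∀ acc x p → acc ≤ p → p < acc + x → Σ ℕ λ u → Σ ℕ λ v → p ≡ acc + u × x ≡ suc u + v
inBlock acc x p acc≤p p<end = u , x ∸ suc u , p≡acc+u , sym (ℕ.m+[n∸m]≡n u<x)
  where
  u = p ∸ acc
  p≡acc+u : p ≡ acc + u
  p≡acc+u = sym (ℕ.m+[n∸m]≡n acc≤p)
  u<x : u < x
  u<x = ℕ.+-cancelˡ-< acc u x (subst (_< acc + x) p≡acc+u p<end)

blockRev-value : ∀ acc u v xs → blockRev acc (suc u + v ∷ xs) (acc + u) ≡ acc + v
blockRev-value acc u v xs = begin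
  blockRev acc (suc u + v ∷ xs) (acc + u) ≡⟨ blockRev-here acc (suc u + v) xs (acc + u) (ℕ.+-monoʳ-< acc (s≤s (ℕ.m≤m+n u v))) ⟩
  acc + (acc + (suc u + v) ∸ suc (acc + u)) ≡⟨ cong (λ z → acc + (z ∸ suc (acc + u))) (shift acc u v) ⟩
  acc + (suc (acc + u) + v ∸ suc (acc + u)) ≡⟨ cong (acc +_) (ℕ.m+n∸m≡n (suc (acc + u)) v) ⟩
  acc + v                                   ∎
  where
  open ≡-Reasoning
  shift : ∀ a u v → a + (suc u + v) ≡ suc (a + u) + v
  shift = solve-∀

blockRev-bounds : ∀ acc xs p → acc ≤ p → p < acc + sum xs → acc ≤ blockRev acc xs p × blockRev acc xs p < acc + sum xs
blockRev-bounds acc []       p acc≤p p<end = acc≤p , p<end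
blockRev-bounds acc (x ∷ xs) p acc≤p p<end with p ℕ.<? acc + x
... | yes here′ with inBlock acc x p acc≤p here′
...   | u , v , refl , refl =
  subst (λ q → acc ≤ q × q < acc + sum (suc u + v ∷ xs)) (sym (blockRev-value acc u v xs))
        (ℕ.m≤m+n acc _ , ℕ.+-monoʳ-< acc (ℕ.≤-trans (s≤s (ℕ.m≤n+m v u)) (ℕ.m≤m+n (suc u + v) (sum xs))))
blockRev-bounds acc (x ∷ xs) p acc≤p p<end | no later =
  subst (λ q → acc ≤ q × q < acc + sum (x ∷ xs)) (sym (blockRev-later acc x xs p later))
        (ℕ.≤-trans (ℕ.m≤m+n acc x) (proj₁ rest) , ℕ.<-≤-trans (proj₂ rest) (ℕ.≤-reflexive (ℕ.+-assoc acc x (sum xs))))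
  where
  rest = blockRev-bounds (acc + x) xs p (ℕ.≮⇒≥ later) (subst (p <_) (sym (ℕ.+-assoc acc x (sum xs))) p<end)

blockRev-firstBlock : ∀ acc x xs k → acc ≤ k → k < acc + x → blockRev acc (x ∷ xs) k < acc + x
blockRev-firstBlock acc x xs k acc≤k k<x with inBlock acc x k acc≤k k<x
... | u , v , refl , refl =
  subst (_< acc + (suc u + v)) (sym (blockRev-value acc u v xs)) (ℕ.+-monoʳ-< acc (s≤s (ℕ.m≤n+m v u)))

blockRev-involutive : ∀ acc xs p → acc ≤ p → p < acc + sum xs → blockRev acc xs (blockRev acc xs p) ≡ p
blockRev-involutive acc []       p acc≤p p<end = refl
blockRev-involutive acc (x ∷ xs) p acc≤p p<end with p ℕ.<? acc + x
... | yes here′ with inBlock acc x p acc≤p here′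
...   | u , v , refl , refl = begin
  blockRev acc (suc u + v ∷ xs) (blockRev acc (suc u + v ∷ xs) (acc + u)) ≡⟨ cong (blockRev acc (suc u + v ∷ xs)) (blockRev-value acc u v xs) ⟩
  blockRev acc (suc u + v ∷ xs) (acc + v)                                   ≡⟨ cong (λ z → blockRev acc (suc z ∷ xs) (acc + v)) (ℕ.+-comm u v) ⟩
  blockRev acc (suc v + u ∷ xs) (acc + v)                                   ≡⟨ blockRev-value acc v u xs ⟩
  acc + u                                                                   ∎
  where open ≡-Reasoning
blockRev-involutive acc (x ∷ xs) p acc≤p p<end | no later = begin
  blockRev acc (x ∷ xs) (blockRev acc (x ∷ xs) p) ≡⟨ cong (blockRev acc (x ∷ xs)) (blockRev-later acc x xs p later) ⟩
  blockRev acc (x ∷ xs) (blockRev (acc + x) xs p) ≡⟨ blockRev-later acc x xs _ (ℕ.≤⇒≯ (proj₁ rest)) ⟩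
  blockRev (acc + x) xs (blockRev (acc + x) xs p) ≡⟨ blockRev-involutive (acc + x) xs p (ℕ.≮⇒≥ later) p<end′ ⟩
  p                                               ∎
  where
  open ≡-Reasoning
  p<end′ = subst (p <_) (sym (ℕ.+-assoc acc x (sum xs))) p<end
  rest = blockRev-bounds (acc + x) xs p (ℕ.≮⇒≥ later) p<end′

blockRev-descends : ∀ acc xs p → acc ≤ p → suc p < acc + sum xs → suc p ∉ psumsFrom acc xs →
                    blockRev acc xs (suc p) < blockRev acc xs p
blockRev-descends acc [] p acc≤p 1+p<end _ =
  ⊥-elim (ℕ.<-irrefl refl (ℕ.<-≤-trans 1+p<end (ℕ.≤-trans (ℕ.≤-reflexive (ℕ.+-identityʳ acc)) (ℕ.≤-trans acc≤p (ℕ.n≤1+n p)))))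
blockRev-descends acc (x ∷ xs) p acc≤p 1+p<end notBoundary with suc p ℕ.<? acc + x
... | yes inside with inBlock acc x p acc≤p (ℕ.<-trans (ℕ.n<1+n p) inside)
...   | u , zero , refl , refl =
  ⊥-elim (ℕ.<-irrefl refl (ℕ.<-≤-trans inside (ℕ.≤-reflexive (trans (cong (acc +_) (ℕ.+-identityʳ (suc u))) (ℕ.+-suc acc u)))))
...   | u , suc v , refl , refl =
  subst₂ _<_ (sym next) (sym (blockRev-value acc u (suc v) xs)) (ℕ.+-monoʳ-< acc (ℕ.n<1+n v))
  where
  next : blockRev acc (suc u + suc v ∷ xs) (suc (acc + u)) ≡ acc + v
  next = trans (cong₂ (λ a b → blockRev acc (a ∷ xs) b) (ℕ.+-suc (suc u) v) (sym (ℕ.+-suc acc u)))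
               (blockRev-value acc (suc u) v xs)
blockRev-descends acc (x ∷ xs) p acc≤p 1+p<end notBoundary | no outside with suc p ℕ.≟ acc + x
blockRev-descends acc (x ∷ []) p acc≤p 1+p<end notBoundary | no outside | _ =
  ⊥-elim (outside (subst (suc p <_) (cong (acc +_) (ℕ.+-identityʳ x)) 1+p<end))
blockRev-descends acc (x ∷ y ∷ ys) p acc≤p 1+p<end notBoundary | no outside | yes boundary =
  ⊥-elim (notBoundary (here boundary))
blockRev-descends acc (x ∷ y ∷ ys) p acc≤p 1+p<end notBoundary | no outside | no ¬boundary =
  subst₂ _<_ (sym (blockRev-later acc x (y ∷ ys) (suc p) outside)) (sym (blockRev-later acc x (y ∷ ys) p p≮))
    (blockRev-descends (acc + x) (y ∷ ys) p x≤p (subst (suc p <_) (sym (ℕ.+-assoc acc x _)) 1+p<end) (notBoundary ∘ there))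
  where
  x≤p : acc + x ≤ p
  x≤p = ℕ.≤-pred (ℕ.≤∧≢⇒< (ℕ.≮⇒≥ outside) (¬boundary ∘ sym))
  p≮ : ¬ (p < acc + x)
  p≮ p<x = ℕ.<-irrefl refl (ℕ.<-≤-trans p<x x≤p)

<blockEnd : ∀ acc xs k → k < blockEnd acc xs k
<blockEnd acc []       k = ℕ.n<1+n k
<blockEnd acc (x ∷ xs) k with k ℕ.<? acc + x
... | yes here′ = subst (k <_) (sym (blockEnd-here acc x xs k here′)) here′
... | no later  = subst (k <_) (sym (blockEnd-later acc x xs k later)) (<blockEnd (acc + x) xs k)

blockRev-laterBlock : ∀ acc xs k t → acc ≤ k → blockEnd acc xs k ≤ t → t < acc + sum xs →
                      blockRev acc xs k < blockRev acc xs t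
blockRev-laterBlock acc [] k t acc≤k end≤t t<end =
  ⊥-elim (ℕ.<-irrefl refl (ℕ.<-≤-trans t<end (ℕ.≤-trans (ℕ.≤-reflexive (ℕ.+-identityʳ acc))
                                                         (ℕ.≤-trans acc≤k (ℕ.≤-trans (ℕ.n≤1+n k) end≤t)))))
blockRev-laterBlock acc (x ∷ xs) k t acc≤k end≤t t<end with k ℕ.<? acc + x
... | yes here′ = ℕ.<-≤-trans (blockRev-firstBlock acc x xs k acc≤k here′) (begin
  acc + x                     ≤⟨ proj₁ (blockRev-bounds (acc + x) xs t x≤t (subst (t <_) (sym (ℕ.+-assoc acc x (sum xs))) t<end)) ⟩
  blockRev (acc + x) xs t     ≡⟨ blockRev-later acc x xs t (ℕ.≤⇒≯ x≤t) ⟨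
  blockRev acc (x ∷ xs) t     ∎)
  where
  open ℕ.≤-Reasoning
  x≤t : acc + x ≤ t
  x≤t = subst (_≤ t) (blockEnd-here acc x xs k here′) end≤t
... | no later = subst₂ _<_ (sym (blockRev-later acc x xs k later)) (sym (blockRev-later acc x xs t (later ∘ ℕ.<-trans k<t)))
    (blockRev-laterBlock (acc + x) xs k t (ℕ.≮⇒≥ later) end≤t′ (subst (t <_) (sym (ℕ.+-assoc acc x (sum xs))) t<end))
  where
  end≤t′ = subst (_≤ t) (blockEnd-later acc x xs k later) end≤t
  k<t : k < t
  k<t = ℕ.<-≤-trans (<blockEnd (acc + x) xs k) end≤t′

-- The longest element of 𝔥_α

-- Its window: every block reversed and negated, except that a join α
-- (sp = false) keeps its first block in place with positive sign.

ωIndex : Bool → List ℕ → ℕ → ℕ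
ωIndex true  xs       p = blockRev 0 xs p
ωIndex false []       p = p
ωIndex false (x ∷ xs) p = if does (p ℕ.<? x) then p else blockRev x xs p

ωNegated : Bool → List ℕ → ℕ → Bool
ωNegated true  xs       p = true
ωNegated false []       p = true
ωNegated false (x ∷ xs) p = not (does (p ℕ.<? x))

ωWindow : Bool → List ℕ → ℕ → ℤ
ωWindow sp xs p = signed (ωNegated sp xs p) (ωIndex sp xs p)

negReach : Bool → List ℕ → ℕ → ℕ
negReach true  xs k = 0
negReach false xs k = firstPart xs ∸ k

ωIndex-fixed : ∀ x xs p → p < x → ωIndex false (x ∷ xs) p ≡ p
ωIndex-fixed x xs p p<x rewrite dec-true (p ℕ.<? x) p<x = refl

ωIndex-moved : ∀ x xs p → ¬ p < x → ωIndex false (x ∷ xs) p ≡ blockRev x xs p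
ωIndex-moved x xs p p≮x rewrite dec-false (p ℕ.<? x) p≮x = refl

ωNegated-moved : ∀ x xs p → ¬ p < x → ωNegated false (x ∷ xs) p ≡ true
ωNegated-moved x xs p p≮x rewrite dec-false (p ℕ.<? x) p≮x = refl

ωWindow-fixed : ∀ x xs p → p < x → ωWindow false (x ∷ xs) p ≡ +[1+ p ]
ωWindow-fixed x xs p p<x rewrite dec-true (p ℕ.<? x) p<x = refl

ωWindow-moved : ∀ x xs p → ¬ p < x → ωWindow false (x ∷ xs) p ≡ -[1+ blockRev x xs p ]
ωWindow-moved x xs p p≮x rewrite dec-false (p ℕ.<? x) p≮x = refl

ωIndex-involution : ∀ sp xs p → p < sum xs →
                    ωIndex sp xs p < sum xs × ωIndex sp xs (ωIndex sp xs p) ≡ p ×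
                    ωNegated sp xs (ωIndex sp xs p) ≡ ωNegated sp xs p
ωIndex-involution true xs p p<n = proj₂ (blockRev-bounds 0 xs p z≤n p<n) , blockRev-involutive 0 xs p z≤n p<n , refl
ωIndex-involution false (x ∷ xs) p p<n with p ℕ.<? x
... | yes fixed = subst Image (sym (ωIndex-fixed x xs p fixed)) (p<n , ωIndex-fixed x xs p fixed , refl)
  where
  Image = λ q → q < sum (x ∷ xs) × ωIndex false (x ∷ xs) q ≡ p × ωNegated false (x ∷ xs) q ≡ ωNegated false (x ∷ xs) p
... | no moved = subst Image (sym (ωIndex-moved x xs p moved))
                       (proj₂ bounds ,
                        trans (ωIndex-moved x xs _ stays) (blockRev-involutive x xs p (ℕ.≮⇒≥ moved) p<n) ,
                        trans (ωNegated-moved x xs _ stays) (sym (ωNegated-moved x xs p moved)))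
  where
  Image = λ q → q < sum (x ∷ xs) × ωIndex false (x ∷ xs) q ≡ p × ωNegated false (x ∷ xs) q ≡ ωNegated false (x ∷ xs) p
  bounds = blockRev-bounds x xs p (ℕ.≮⇒≥ moved) p<n
  stays : ¬ (blockRev x xs p < x)
  stays = ℕ.≤⇒≯ (proj₁ bounds)

ωWindow-ascent : ∀ sp xs p → suc p < sum xs → suc p ∉ psums xs → ωWindow sp xs p <ℤ ωWindow sp xs (suc p)
ωWindow-ascent true  xs       p 1+p<n ¬boundary = -<- (blockRev-descends 0 xs p z≤n 1+p<n ¬boundary)
ωWindow-ascent false (x ∷ ys) p 1+p<n ¬boundary with suc p ℕ.<? x
... | yes fixed = subst₂ _<ℤ_ (sym (ωWindow-fixed x ys p (ℕ.<-trans (ℕ.n<1+n p) fixed)))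
                              (sym (ωWindow-fixed x ys (suc p) fixed)) (+<+ (ℕ.n<1+n (suc p)))
... | no moved with suc p ℕ.≟ x
ωWindow-ascent false (x ∷ [])     p 1+p<n ¬boundary | no moved | _ =
  ⊥-elim (moved (subst (suc p <_) (ℕ.+-identityʳ x) 1+p<n))
ωWindow-ascent false (x ∷ y ∷ zs) p 1+p<n ¬boundary | no moved | yes boundary =
  ⊥-elim (¬boundary (here boundary))
ωWindow-ascent false (x ∷ y ∷ zs) p 1+p<n ¬boundary | no moved | no 1+p≢x =
  subst₂ _<ℤ_ (sym (ωWindow-moved x (y ∷ zs) p (ℕ.≤⇒≯ x≤p))) (sym (ωWindow-moved x (y ∷ zs) (suc p) moved))
    (-<- (blockRev-descends x (y ∷ zs) p x≤p 1+p<n (¬boundary ∘ there)))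
  where
  x≤p : x ≤ p
  x≤p = ℕ.≤-pred (ℕ.≤∧≢⇒< (ℕ.≮⇒≥ moved) (1+p≢x ∘ sym))

ωWindow-head-positive : ∀ x ys → 0 < x → 0ℤ <ℤ ωWindow false (x ∷ ys) 0
ωWindow-head-positive x ys 0<x = subst (0ℤ <ℤ_) (sym (ωWindow-fixed x ys 0 0<x)) (+<+ (s≤s z≤n))

ωWindow-laterBlock : ∀ sp xs k t → blockEnd 0 xs k ≤ t → t < sum xs → ωWindow sp xs t <ℤ ωWindow sp xs k
ωWindow-laterBlock true  xs       k t end≤t t<n = -<- (blockRev-laterBlock 0 xs k t z≤n end≤t t<n)
ωWindow-laterBlock false (x ∷ ys) k t end≤t t<n with k ℕ.<? x
... | yes fixed = subst₂ _<ℤ_ (sym (ωWindow-moved x ys t (ℕ.≤⇒≯ x≤t))) (sym (ωWindow-fixed x ys k fixed)) -<+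
  where
  x≤t = subst (_≤ t) (blockEnd-here 0 x ys k fixed) end≤t
... | no moved = subst₂ _<ℤ_ (sym (ωWindow-moved x ys t (moved ∘ ℕ.<-trans k<t))) (sym (ωWindow-moved x ys k moved))
                        (-<- (blockRev-laterBlock x ys k t (ℕ.≮⇒≥ moved) end≤t′ t<n))
  where
  end≤t′ = subst (_≤ t) (blockEnd-later 0 x ys k moved) end≤t
  k<t = ℕ.<-≤-trans (<blockEnd x ys k) end≤t′

ωWindow-negative : ∀ sp xs k → negReach sp xs k ≡ 0 → ωWindow sp xs k <ℤ 0ℤ
ωWindow-negative true  xs       k _    = -<+
ωWindow-negative false []       k _    = -<+
ωWindow-negative false (x ∷ ys) k x≤k = subst (_<ℤ 0ℤ) (sym (ωWindow-moved x ys k (ℕ.≤⇒≯ (ℕ.m∸n≡0⇒m≤n x≤k)))) -<+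

ωWindow-negPair : ∀ sp xs k t → k < t → k + negReach sp xs k ≤ t → t < sum xs →
                  ωWindow sp xs t <ℤ - ωWindow sp xs k
ωWindow-negPair true  xs       k t _   _      _   = -<+
ωWindow-negPair false (x ∷ ys) k t k<t k+r≤t t<n with k ℕ.<? x
... | yes fixed = subst₂ _<ℤ_ (sym (ωWindow-moved x ys t (ℕ.≤⇒≯ x≤t))) (sym (cong -_ (ωWindow-fixed x ys k fixed)))
                         (-<- (ℕ.<-≤-trans fixed (proj₁ (blockRev-bounds x ys t x≤t t<n))))
  where
  x≤t = ℕ.≤-trans (ℕ.m≤n+m∸n x k) k+r≤t
... | no moved = subst₂ _<ℤ_ (sym (ωWindow-moved x ys t (moved ∘ ℕ.<-trans k<t))) (sym (cong -_ (ωWindow-moved x ys k moved))) -<+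

ω : ∀ sp xs → SFin (sum xs) → SFin (sum xs)
ω sp xs (b , a) = ωNegated sp xs (toℕ a) xor b , fromℕ< (proj₁ (ωIndex-involution sp xs (toℕ a) (toℕ<n a)))

ω-involutive : ∀ sp xs s → ω sp xs (ω sp xs s) ≡ s
ω-involutive sp xs (b , a) = cong₂ _,_ sign (toℕ-injective index)
  where
  p = toℕ a
  invol = ωIndex-involution sp xs p (toℕ<n a)
  a′ = fromℕ< (proj₁ invol)
  toℕ-a′ : toℕ a′ ≡ ωIndex sp xs p
  toℕ-a′ = toℕ-fromℕ< (proj₁ invol)
  c = ωNegated sp xs p
  sign : ωNegated sp xs (toℕ a′) xor (c xor b) ≡ b
  sign = begin
    ωNegated sp xs (toℕ a′) xor (c xor b) ≡⟨ cong (λ d → d xor (c xor b)) (trans (cong (ωNegated sp xs) toℕ-a′) (proj₂ (proj₂ invol))) ⟩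
    c xor (c xor b)                       ≡⟨ xor-assoc c c b ⟨
    (c xor c) xor b                       ≡⟨ cong (_xor b) (xor-same c) ⟩
    b                                     ∎
    where open ≡-Reasoning
  index : toℕ (proj₂ (ω sp xs (ω sp xs (b , a)))) ≡ toℕ a
  index = trans (toℕ-fromℕ< _) (trans (cong (ωIndex sp xs) toℕ-a′) (proj₁ (proj₂ invol)))

ω-odd : ∀ sp xs → Odd (ω sp xs)
ω-odd sp xs (b , a) = cong (_, _) (sym (not-distribʳ-xor (ωNegated sp xs (toℕ a)) b))

ω-injective : ∀ sp xs → Injective (ω sp xs)
ω-injective sp xs a b e = trans (sym (ω-involutive sp xs a)) (trans (cong (ω sp xs) e) (ω-involutive sp xs b))

ωHyp : ∀ sp xs → Hyp (sum xs)
ωHyp sp xs = record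
  { perm = mk↔ₛ′ (ω sp xs) (ω sp xs) (ω-involutive sp xs) (ω-involutive sp xs)
  ; odd  = ω-odd sp xs
  }

window-ω : ∀ sp xs p → p < sum xs → window (ω sp xs) p ≡ ωWindow sp xs p
window-ω sp xs p p<n = begin
  window (ω sp xs) p                                   ≡⟨ window-fromℕ< (ω sp xs) p p<n ⟩
  signed (ωNegated sp xs (toℕ a) xor false) (toℕ a′)   ≡⟨ cong₂ signed (xor-identityʳ _) (toℕ-fromℕ< _) ⟩
  signed (ωNegated sp xs (toℕ a)) (ωIndex sp xs (toℕ a)) ≡⟨ cong (ωWindow sp xs) (toℕ-fromℕ< p<n) ⟩
  ωWindow sp xs p                                      ∎
  where
  open ≡-Reasoning
  a = fromℕ< p<n
  a′ = proj₂ (ω sp xs (false , a))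

C2≡triangle : ∀ m → m C 2 ≡ triangle m
C2≡triangle zero    = refl
C2≡triangle (suc m) = trans (sym (nCk+nC[k+1]≡[n+1]C[k+1] m 1)) (cong₂ _+_ (nC1≡n m) (C2≡triangle m))

square≡triangle+triangle : ∀ n → n * n ≡ triangle n + triangle (suc n)
square≡triangle+triangle zero    = refl
square≡triangle+triangle (suc n) = begin
  suc n * suc n                                 ≡⟨ expand n ⟩
  n * n + (n + suc n)                           ≡⟨ cong (_+ (n + suc n)) (square≡triangle+triangle n) ⟩
  triangle n + (n + triangle n) + (n + suc n)   ≡⟨ rearrange n (triangle n) ⟩
  (n + triangle n) + (suc n + (n + triangle n)) ∎
  where
  open ≡-Reasoning
  expand : ∀ n → suc n * suc n ≡ n * n + (n + suc n)
  expand = solve-∀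
  rearrange : ∀ n t → t + (n + t) + (n + suc n) ≡ (n + t) + (suc n + (n + t))
  rearrange = solve-∀

joinCorrection : Bool → List ℕ → ℕ
joinCorrection true  xs = 0
joinCorrection false xs = triangle (suc (firstPart xs))

maxLength : Bool → List ℕ → ℕ
maxLength sp xs = triangle (sum xs) + triangle (suc (sum xs)) ∸ sum (map triangle xs) ∸ joinCorrection sp xs

lengthFormula≡maxLength : ∀ {n} (α : BComp n) → lengthFormula α ≡ maxLength (split α) (parts α)
lengthFormula≡maxLength record { split = sp ; parts = xs ; total = refl } =
  cong₂ _∸_ (cong₂ _∸_ (square≡triangle+triangle (sum xs)) (cong sum (List.map-cong C2≡triangle xs))) (correction sp)
  where
  correction : ∀ sp → (if sp then 0 else (suc (firstPart xs) C 2)) ≡ joinCorrection sp xs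
  correction true  = refl
  correction false = C2≡triangle (suc (firstPart xs))

+≤∸∸ : ∀ a b s₁ s₂ T₁ T₂ → a + s₁ ≤ T₁ → b + s₂ ≤ T₂ → a + b ≤ T₁ + T₂ ∸ s₁ ∸ s₂
+≤∸∸ a b s₁ s₂ T₁ T₂ h₁ h₂ = begin
  a + b                     ≤⟨ ℕ.m+n≤o⇒m≤o∸n (a + b) (begin
    a + b + (s₁ + s₂)         ≡⟨ interchange a b s₁ s₂ ⟩
    a + s₁ + (b + s₂)         ≤⟨ ℕ.+-mono-≤ h₁ h₂ ⟩
    T₁ + T₂                   ∎) ⟩
  T₁ + T₂ ∸ (s₁ + s₂)       ≡⟨ ℕ.∸-+-assoc (T₁ + T₂) s₁ s₂ ⟨
  T₁ + T₂ ∸ s₁ ∸ s₂         ∎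
  where open ℕ.≤-Reasoning

∸∸≤+ : ∀ a b s₁ s₂ T₁ T₂ → T₁ ≤ a + s₁ → T₂ ≤ b + s₂ → T₁ + T₂ ∸ s₁ ∸ s₂ ≤ a + b
∸∸≤+ a b s₁ s₂ T₁ T₂ h₁ h₂ = begin
  T₁ + T₂ ∸ s₁ ∸ s₂         ≡⟨ ℕ.∸-+-assoc (T₁ + T₂) s₁ s₂ ⟩
  T₁ + T₂ ∸ (s₁ + s₂)       ≤⟨ ℕ.∸-monoˡ-≤ (s₁ + s₂) (ℕ.+-mono-≤ h₁ h₂) ⟩
  a + s₁ + (b + s₂) ∸ (s₁ + s₂) ≡⟨ cong (_∸ (s₁ + s₂)) (interchange a s₁ b s₂) ⟩
  a + b + (s₁ + s₂) ∸ (s₁ + s₂) ≡⟨ ℕ.m+n∸n≡m (a + b) (s₁ + s₂) ⟩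
  a + b                     ∎
  where open ℕ.≤-Reasoning

firstPart≤sum : ∀ xs → firstPart xs ≤ sum xs
firstPart≤sum []       = z≤n
firstPart≤sum (x ∷ xs) = ℕ.m≤m+n x _

blockReach : List ℕ → ℕ → ℕ
blockReach xs k = blockEnd 0 xs k ∸ suc k

suc[k+blockReach] : ∀ xs k → suc (k + blockReach xs k) ≡ blockEnd 0 xs k
suc[k+blockReach] xs k = ℕ.m+[n∸m]≡n (<blockEnd 0 xs k)

k+blockReach<sum : ∀ xs k → k < sum xs → k + blockReach xs k < sum xs
k+blockReach<sum xs k k<n = ℕ.≤-trans (ℕ.≤-reflexive (suc[k+blockReach] xs k)) (proj₂ (blockEnd-bounds 0 xs k k<n))

m+[n∸m]≡m : ∀ {m n} → n ≤ m → m + (n ∸ m) ≡ m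
m+[n∸m]≡m {m} n≤m = trans (cong (m +_) (ℕ.m≤n⇒m∸n≡0 n≤m)) (ℕ.+-identityʳ m)

k+negReach≤sum : ∀ sp xs k → k < sum xs → k + negReach sp xs k ≤ sum xs
k+negReach≤sum true  xs k k<n = ℕ.≤-trans (ℕ.≤-reflexive (ℕ.+-identityʳ k)) (ℕ.<⇒≤ k<n)
k+negReach≤sum false xs k k<n with k ℕ.≤? firstPart xs
... | yes k≤x = ℕ.≤-trans (ℕ.≤-reflexive (ℕ.m+[n∸m]≡n k≤x)) (firstPart≤sum xs)
... | no  k≰x = ℕ.≤-trans (ℕ.≤-reflexive (m+[n∸m]≡m (ℕ.<⇒≤ (ℕ.≰⇒> k≰x)))) (ℕ.<⇒≤ k<n)

<k+negReach⇒firstBlock : ∀ sp xs k t → k ≤ t → t < k + negReach sp xs k → sp ≡ false × t < firstPart xs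
<k+negReach⇒firstBlock true  xs k t k≤t t<k+0 = ⊥-elim (ℕ.<-irrefl refl (ℕ.<-≤-trans t<k+0 (ℕ.≤-trans (ℕ.≤-reflexive (ℕ.+-identityʳ k)) k≤t)))
<k+negReach⇒firstBlock false xs k t k≤t t< with k ℕ.≤? firstPart xs
... | yes k≤x = refl , subst (t <_) (ℕ.m+[n∸m]≡n k≤x) t<
... | no  k≰x = ⊥-elim (ℕ.<-irrefl refl (ℕ.<-≤-trans t< (ℕ.≤-trans (ℕ.≤-reflexive (m+[n∸m]≡m (ℕ.<⇒≤ (ℕ.≰⇒> k≰x)))) k≤t)))

sumTo-negReach : ∀ sp xs → sumTo (sum xs) (negReach sp xs) ≡ joinCorrection sp xs
sumTo-negReach true  xs = sumTo-zero (sum xs) (negReach true xs) (λ _ → refl)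
sumTo-negReach false xs = sumTo-truncated (firstPart xs) (sum xs) (firstPart≤sum xs)

firstBlock-¬boundary : ∀ xs p → p < firstPart xs → p ∉ psums xs
firstBlock-¬boundary (x ∷ ys) p p<x boundary = ℕ.<-irrefl refl (ℕ.<-≤-trans p<x (psumsFrom-≥ 0 x ys p boundary))

-- The two hypotheses say that Ω has no descent at any generator outside J_α.
lengthB≤maxLength : ∀ sp xs Ω → (sp ≡ false → 0 < sum xs → 0ℤ ≤ℤ Ω 0) →
                    (∀ p → suc p < sum xs → suc p ∉ psums xs → Ω p ≤ℤ Ω (suc p)) →
                    lengthB (sum xs) Ω ≤ maxLength sp xs
lengthB≤maxLength sp xs Ω head incr = +≤∸∸ (inv n Ω) (negInv n Ω) _ _ _ _
  (subst (λ s → inv n Ω + s ≤ triangle n) (sumTo-blockReach 0 xs)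
    (inv+reach≤triangle n Ω (blockReach xs) (k+blockReach<sum xs) sameBlock))
  (subst (λ s → negInv n Ω + s ≤ triangle (suc n)) (sumTo-negReach sp xs)
    (negInv+reach≤triangle n Ω (negReach sp xs) (k+negReach≤sum sp xs) firstBlock))
  where
  n = sum xs
  sameBlock : ∀ k t → k < n → k < t → t ≤ k + blockReach xs k → Ω k ≤ℤ Ω t
  sameBlock k t k<n k<t t≤ = increasing⇒≤ Ω k (k + blockReach xs k) step t (ℕ.<⇒≤ k<t) t≤
    where
    step : ∀ p → k ≤ p → p < k + blockReach xs k → Ω p ≤ℤ Ω (suc p)
    step p k≤p p< = incr p (ℕ.≤-<-trans p< (k+blockReach<sum xs k k<n))
      (¬boundary<blockEnd 0 xs k p k≤p (ℕ.<-≤-trans (s≤s p<) (ℕ.≤-reflexive (suc[k+blockReach] xs k))))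
  firstBlock : ∀ k t → k < n → k ≤ t → t < k + negReach sp xs k → 0ℤ ≤ℤ Ω t
  firstBlock k t k<n k≤t t< with <k+negReach⇒firstBlock sp xs k t k≤t t<
  ... | join , t<x = ℤ.≤-trans (head join (ℕ.≤-<-trans z≤n t<n))
                      (increasing⇒≤ Ω 0 t step t z≤n ℕ.≤-refl)
    where
    t<n = ℕ.<-≤-trans t<x (firstPart≤sum xs)
    step : ∀ p → 0 ≤ p → p < t → Ω p ≤ℤ Ω (suc p)
    step p _ p<t = incr p (ℕ.≤-<-trans p<t t<n) (firstBlock-¬boundary xs (suc p) (ℕ.≤-<-trans p<t t<x))

maxLength≤lengthB : ∀ sp xs Ω → (∀ p → p < sum xs → Ω p ≡ ωWindow sp xs p) →
                    maxLength sp xs ≤ lengthB (sum xs) Ω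
maxLength≤lengthB sp xs Ω Ω≡ω = ∸∸≤+ (inv n Ω) (negInv n Ω) _ _ _ _
  (subst (λ s → triangle n ≤ inv n Ω + s) (sumTo-blockReach 0 xs)
    (triangle≤inv+reach n Ω (blockReach xs) laterBlock))
  (subst (λ s → triangle (suc n) ≤ negInv n Ω + s) (sumTo-negReach sp xs)
    (triangle≤negInv+reach n Ω (negReach sp xs) negative negPair))
  where
  n = sum xs
  laterBlock : ∀ k t → k + blockReach xs k < t → t < n → Ω t <ℤ Ω k
  laterBlock k t k+r<t t<n = subst₂ _<ℤ_ (sym (Ω≡ω t t<n)) (sym (Ω≡ω k k<n))
    (ωWindow-laterBlock sp xs k t (subst (_≤ t) (suc[k+blockReach] xs k) k+r<t) t<n)
    where
    k<n = ℕ.≤-<-trans (ℕ.m≤m+n k _) (ℕ.<-trans k+r<t t<n)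
  negative : ∀ k → k < n → negReach sp xs k ≡ 0 → Ω k <ℤ 0ℤ
  negative k k<n r≡0 = subst (_<ℤ 0ℤ) (sym (Ω≡ω k k<n)) (ωWindow-negative sp xs k r≡0)
  negPair : ∀ k t → k < t → k + negReach sp xs k ≤ t → t < n → Ω t <ℤ - Ω k
  negPair k t k<t k+r≤t t<n = subst₂ (λ a b → a <ℤ - b) (sym (Ω≡ω t t<n)) (sym (Ω≡ω k (ℕ.<-trans k<t t<n)))
    (ωWindow-negPair sp xs k t k<t k+r≤t t<n)

bcomp : ∀ sp xs → All (0 <_) xs → BComp (sum xs)
bcomp sp xs ps = record { split = sp ; parts = xs ; pos = ps ; total = refl }

InJ-zero⇒split : ∀ sp xs ps (i : Fin (sum xs)) → toℕ i ≡ 0 → ¬ InJ (bcomp sp xs ps) i → sp ≡ false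
InJ-zero⇒split true  xs ps i i≡0 ¬J = ⊥-elim (¬J (inj₁ (refl , i≡0)))
InJ-zero⇒split false xs ps i i≡0 ¬J = refl

¬InJ-zero : ∀ xs ps (i : Fin (sum xs)) → toℕ i ≡ 0 → ¬ InJ (bcomp false xs ps) i
¬InJ-zero xs       ps         i i≡0 (inj₁ (() , _))
¬InJ-zero (x ∷ ys) (0<x ∷ _)  i i≡0 (inj₂ boundary) =
  firstBlock-¬boundary (x ∷ ys) 0 0<x (subst (_∈ psums (x ∷ ys)) i≡0 boundary)

¬InJ-suc : ∀ sp xs ps (i : Fin (sum xs)) p → toℕ i ≡ suc p → suc p ∉ psums xs → ¬ InJ (bcomp sp xs ps) i
¬InJ-suc sp xs ps i p i≡1+p _ (inj₁ (_ , i≡0)) = ℕ.1+n≢0 (trans (sym i≡1+p) i≡0)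
¬InJ-suc sp xs ps i p i≡1+p ¬boundary (inj₂ boundary) = ¬boundary (subst (_∈ psums xs) i≡1+p boundary)

¬InJ-suc⇒¬boundary : ∀ sp xs ps (i : Fin (sum xs)) p → toℕ i ≡ suc p → ¬ InJ (bcomp sp xs ps) i →
                     suc p ∉ psums xs
¬InJ-suc⇒¬boundary sp xs ps i p i≡1+p ¬J boundary = ¬J (inj₂ (subst (_∈ psums xs) (sym i≡1+p) boundary))

ω-head : ∀ sp xs → All (0 <_) xs → sp ≡ false → 0 < sum xs → 0ℤ <ℤ window (ω sp xs) 0
ω-head .false (x ∷ ys) (0<x ∷ _) refl 0<n =
  subst (0ℤ <ℤ_) (sym (window-ω false (x ∷ ys) 0 0<n)) (ωWindow-head-positive x ys 0<x)

ω-step : ∀ sp xs p → suc p < sum xs → suc p ∉ psums xs → window (ω sp xs) p <ℤ window (ω sp xs) (suc p)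
ω-step sp xs p 1+p<n ¬boundary =
  subst₂ _<ℤ_ (sym (window-ω sp xs p (ℕ.<-trans (ℕ.n<1+n p) 1+p<n))) (sym (window-ω sp xs (suc p) 1+p<n))
    (ωWindow-ascent sp xs p 1+p<n ¬boundary)

ℓ-ω : ∀ sp xs → All (0 <_) xs → ℓ (ω sp xs) ≡ maxLength sp xs
ℓ-ω sp xs ps = ℕ.≤-antisym
  (lengthB≤maxLength sp xs (window (ω sp xs)) (λ join 0<n → ℤ.<⇒≤ (ω-head sp xs ps join 0<n))
                                             (λ p 1+p<n ¬b → ℤ.<⇒≤ (ω-step sp xs p 1+p<n ¬b)))
  (maxLength≤lengthB sp xs (window (ω sp xs)) (window-ω sp xs))

ω-ascent : ∀ sp xs ps (i : Fin (sum xs)) → ¬ InJ (bcomp sp xs ps) i → isAscent (window (ω sp xs)) (toℕ i) ≡ true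
ω-ascent sp xs ps i ¬J = ascent (toℕ i) refl (toℕ<n i)
  where
  ascent : ∀ k → toℕ i ≡ k → k < sum xs → isAscent (window (ω sp xs)) k ≡ true
  ascent zero    i≡0   0<n   = <ᵇ-true (ℤ.neg-mono-< (ω-head sp xs ps (InJ-zero⇒split sp xs ps i i≡0 ¬J) 0<n))
  ascent (suc p) i≡1+p 1+p<n = <ᵇ-true (ω-step sp xs p 1+p<n (¬InJ-suc⇒¬boundary sp xs ps i p i≡1+p ¬J))

inHα⇒ℓ≤maxLength : ∀ sp xs ps (w : Hyp (sum xs)) → InHα (bcomp sp xs ps) w → ℓ (fun w) ≤ maxLength sp xs
inHα⇒ℓ≤maxLength sp xs ps w w∈H = lengthB≤maxLength sp xs Ω head incr
  where
  f = fun w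
  Ω = window f
  noDescent : ∀ i → ¬ InJ (bcomp sp xs ps) i → isDescent Ω (toℕ i) ≡ false
  noDescent i ¬J = ℓ-gen>⇒¬descent f (odd w) i
    (w∈H i ¬J _ _ (hasLength-ℓ f (odd w) (hyp-injective w)) (hasLength-ℓ∘gen f (odd w) (hyp-injective w) i))
  noDescentAt : ∀ k (k<n : k < sum xs) → ¬ InJ (bcomp sp xs ps) (fromℕ< k<n) → isDescent Ω k ≡ false
  noDescentAt k k<n ¬J = subst (λ j → isDescent Ω j ≡ false) (toℕ-fromℕ< k<n) (noDescent (fromℕ< k<n) ¬J)
  head : sp ≡ false → 0 < sum xs → 0ℤ ≤ℤ Ω 0
  head join 0<n = <ᵇ-false⇒≥ {Ω 0} (noDescentAt 0 0<n
    (subst (λ s → ¬ InJ (bcomp s xs ps) (fromℕ< 0<n)) (sym join) (¬InJ-zero xs ps (fromℕ< 0<n) (toℕ-fromℕ< 0<n))))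
  incr : ∀ p → suc p < sum xs → suc p ∉ psums xs → Ω p ≤ℤ Ω (suc p)
  incr p 1+p<n ¬boundary = <ᵇ-false⇒≥ {Ω (suc p)} (noDescentAt (suc p) 1+p<n
    (¬InJ-suc sp xs ps (fromℕ< 1+p<n) p (toℕ-fromℕ< 1+p<n) ¬boundary))

ω∈𝔥α : ∀ sp xs ps → InHα (bcomp sp xs ps) (ωHyp sp xs)
ω∈𝔥α sp xs ps i ¬J k m hasK hasM = begin-strict
  k                       ≡⟨ hasLength-unique hasK (hasLength-ℓ (ω sp xs) ω-odd′ ω-inj′) ⟩
  ℓ (ω sp xs)             <⟨ ℕ.n<1+n _ ⟩
  suc (ℓ (ω sp xs))       ≡⟨ ℓ-ascent (ω sp xs) ω-odd′ i (ω-ascent sp xs ps i ¬J) ⟨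
  ℓ (ω sp xs ∘ gen i)     ≡⟨ hasLength-unique (hasLength-ℓ∘gen (ω sp xs) ω-odd′ ω-inj′ i) hasM ⟩
  m                       ∎
  where
  open ℕ.≤-Reasoning
  ω-odd′ = ω-odd sp xs
  ω-inj′ = ω-injective sp xs

corollary36 : (n : ℕ) (α : BComp n) → MaxLengthIs α (lengthFormula α)
corollary36 .(sum xs) α@record { split = sp ; parts = xs ; pos = ps ; total = refl } =
  (ωHyp sp xs , ω∈𝔥α sp xs ps , ω-length) , maximal
  where
  ω-length : HasLength (ω sp xs) (lengthFormula α)
  ω-length = subst (HasLength (ω sp xs)) (trans (ℓ-ω sp xs ps) (sym (lengthFormula≡maxLength α)))
                   (hasLength-ℓ (ω sp xs) (ω-odd sp xs) (ω-injective sp xs))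
  maximal : ∀ w → InHα α w → ∀ k → HasLength (fun w) k → k ≤ lengthFormula α
  maximal w w∈𝔥α k hasK = begin
    k               ≡⟨ hasLength-unique hasK (hasLength-ℓ (fun w) (odd w) (hyp-injective w)) ⟩
    ℓ (fun w)       ≤⟨ inHα⇒ℓ≤maxLength sp xs ps w w∈𝔥α ⟩
    maxLength sp xs ≡⟨ lengthFormula≡maxLength α ⟨
    lengthFormula α ∎
    where open ℕ.≤-Reasoning
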